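{- For a building set $\mathcal{B}$ on $[n]$, the $f$-polynomial of the extended nestohedron $\mathcal{P}^{\square}(\mathcal{B})$ satisfies $$f_{\mathcal{P}^{\square}(\mathcal{B})}(t)=\sum_{S\subseteq[n]}(t+1)^{n-|S|}f_{\mathcal{P}(\mathcal{B}|_S)}(t)\quad\text{and}\quad f_{\mathcal{P}^{\square}(\mathcal{B})}(t)=\sum_{S\subseteq[n]}(t+1)^{|(\mathcal{B}|_S)_{\max}|}f_{\mathcal{P}(\mathcal{B}|_S)}(t).$$
   Context: A building set on a finite set $X$ is a collection $\mathcal{B}$ of nonempty subsets of $X$ such that $\{i\}\in\mathcal{B}$ for all $i\in X$, and $I\cup J\in\mathcal{B}$ whenever $I,J\in\mathcal{B}$ with $I\cap J\ne\varnothing$. $\mathcal{B}_{\max}$ is the set of inclusion-maximal elements of $\mathcal{B}$. For $S\subseteq X$, $\mathcal{B}|_S=\{J\in\mathcal{B}:J\subseteq S\}$, a building set on $S$ ($\mathcal{B}|_\varnothing$ is the empty building set on $\varnothing$). A nested collection of $\mathcal{B}$ is a subset $N\subseteq\mathcal{B}\setminus\mathcal{B}_{\max}$ such that any two members are nested or disjoint, and for any $k\ge2$ pairwise disjoint members their union is not in $\mathcal{B}$. An extended nested collection is a set $\{I_1,\dots,I_m,x_{i_1},\dots,x_{i_r}\}$ with $I_j\in\mathcal{B}$ (maximal elements allowed), formal symbols $x_i$ with $i\in X$, such that the $I_j$ are pairwise nested or disjoint, no union of $k\ge2$ pairwise disjoint $I_j$'s lies in $\mathcal{B}$, and no $i_\ell$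 lies in any $I_j$. The nestohedron $\mathcal{P}(\mathcal{B})$ is a simple polytope of dimension $d=|X|-|\mathcal{B}_{\max}|$ whose number $f_i$ of $i$-dimensional faces equals the number of nested collections of cardinality $d-i$ ($0\le i\le d$); the extended nestohedron $\mathcal{P}^{\square}(\mathcal{B})$ is a simple polytope of dimension $|X|$ whose number $f_i$ of $i$-dimensional faces equals the number of extended nested collections of cardinality $|X|-i$. (They are the polar duals of simplicial polytopes whose boundary complexes are the complex of nested collections, resp. extended nested collections.) For the empty building set both are a point. The $f$-polynomial of a $d$-dimensional polytope $P$ is $f_P(t)=\sum_{i=0}^d f_i t^i$. -}

module Defs where

open import Data.Bool using (Bool; true; false; not; _∧_; _∨_; if_then_else_)
open import Data.Nat using (ℕ; zero; suc; _+_; _∸_; _≤ᵇ_; _≡ᵇ_)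
open import Data.Fin using (Fin)
open import Data.Fin.Subset using (Subset; _∩_; _∪_; ⁅_⁆; ∣_∣; Nonempty; ⊥)
open import Data.List using (List; []; _∷_; _++_; map; length; foldr)
open import Data.Bool.ListAction using (all; any)
open import Data.Vec using ([]; _∷_)
open import Data.Product using (_×_; _,_)
open import Relation.Binary.PropositionalEquality using (_≡_)
open import Relation.Nullary.Decidable using (Dec; yes; no)

allSubsets : ∀ n → List (Subset n)
allSubsets zero    = [] ∷ []
allSubsets (suc n) = map (true ∷_) (allSubsets n) ++ map (false ∷_) (allSubsets n)

filterᵇ : ∀ {A : Set} → (A → Bool) → List A → List A
filterᵇ p []       = []
filterᵇ p (x ∷ xs) = if p x then x ∷ filterᵇ p xs else filterᵇ p xs

sublists : ∀ {A : Set} → List A → List (List A)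
sublists []       = [] ∷ []
sublists (x ∷ xs) = map (x ∷_) (sublists xs) ++ sublists xs

subᵇ : ∀ {n} → Subset n → Subset n → Bool
subᵇ []      []      = true
subᵇ (a ∷ I) (b ∷ J) = (not a ∨ b) ∧ subᵇ I J

disjᵇ : ∀ {n} → Subset n → Subset n → Bool
disjᵇ I J = ∣ I ∩ J ∣ ≡ᵇ 0

ssubᵇ : ∀ {n} → Subset n → Subset n → Bool
ssubᵇ I J = subᵇ I J ∧ not (subᵇ J I)

⋃ : ∀ {n} → List (Subset n) → Subset n
⋃ = foldr _∪_ ⊥

IsBuildingSet : ∀ {n} → (Subset n → Bool) → Set
IsBuildingSet {n} B =
  (∀ (I : Subset n) → B I ≡ true → Nonempty I) ×
  (∀ (i : Fin n) → B ⁅ i ⁆ ≡ true) ×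
  (∀ (I J : Subset n) → B I ≡ true → B J ≡ true → Nonempty (I ∩ J) → B (I ∪ J) ≡ true)

inRestrᵇ : ∀ {n} → (Subset n → Bool) → Subset n → Subset n → Bool
inRestrᵇ B S I = B I ∧ subᵇ I S

isMaxᵇ : ∀ {n} → (Subset n → Bool) → Subset n → Subset n → Bool
isMaxᵇ {n} B S I =
  inRestrᵇ B S I ∧ not (any (λ J → inRestrᵇ B S J ∧ ssubᵇ I J) (allSubsets n))

numMax : ∀ {n} → (Subset n → Bool) → Subset n → ℕ
numMax {n} B S = length (filterᵇ (λ I → isMaxᵇ B S I) (allSubsets n))

pairwiseNDᵇ : ∀ {n} → List (Subset n) → Bool
pairwiseNDᵇ N = all (λ I → all (λ J → subᵇ I J ∨ subᵇ J I ∨ disjᵇ I J) N) N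

pairwiseDisjᵇ : ∀ {n} → List (Subset n) → Bool
pairwiseDisjᵇ [] = true
pairwiseDisjᵇ (I ∷ M) = all (λ J → disjᵇ I J) M ∧ pairwiseDisjᵇ M

unionCondᵇ : ∀ {n} → (Subset n → Bool) → List (Subset n) → Bool
unionCondᵇ B N =
  all (λ M → not ((2 ≤ᵇ length M) ∧ pairwiseDisjᵇ M ∧ B (⋃ M))) (sublists N)

isNestedᵇ : ∀ {n} → (Subset n → Bool) → Subset n → List (Subset n) → Bool
isNestedᵇ B S N =
  all (λ I → inRestrᵇ B S I ∧ not (isMaxᵇ B S I)) N ∧ pairwiseNDᵇ N ∧ unionCondᵇ B N

numNested : ∀ {n} → (Subset n → Bool) → Subset n → ℕ → ℕ
numNested {n} B S k =
  length (filterᵇ (λ N → isNestedᵇ B S N ∧ (length N ≡ᵇ k)) (sublists (allSubsets n)))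

-- (N, R) is an extended nested collection {I ∈ N} ∪ {x_i : i ∈ R} of B
isExtNestedᵇ : ∀ {n} → (Subset n → Bool) → List (Subset n) → Subset n → Bool
isExtNestedᵇ B N R =
  all B N ∧ pairwiseNDᵇ N ∧ unionCondᵇ B N ∧ all (λ I → disjᵇ R I) N

numExtNested : ∀ {n} → (Subset n → Bool) → ℕ → ℕ
numExtNested {n} B k =
  length (filterᵇ (λ NR → isExtNestedᵇ B (NRfst NR) (NRsnd NR) ∧ (length (NRfst NR) + ∣ NRsnd NR ∣ ≡ᵇ k))
                 (pairs (sublists (allSubsets n)) (allSubsets n)))
  where
  NRfst : List (Subset n) × Subset n → List (Subset n)
  NRfst (N , _) = N
  NRsnd : List (Subset n) × Subset n → Subset n
  NRsnd (_ , R) = R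
  pairs : List (List (Subset n)) → List (Subset n) → List (List (Subset n) × Subset n)
  pairs xs ys = foldr (λ x acc → map (x ,_) ys ++ acc) [] xs

-- Polynomials in t with ℕ coefficients, as coefficient functions
-- (p i = coefficient of t^i); equality = equality of all coefficients.

Poly : Set
Poly = ℕ → ℕ

mulT1 : Poly → Poly
mulT1 p zero    = p zero
mulT1 p (suc i) = p (suc i) + p i

mulT1^ : ℕ → Poly → Poly
mulT1^ zero    p = p
mulT1^ (suc k) p = mulT1 (mulT1^ k p)

sumSubsets : ∀ n → (Subset n → Poly) → Poly
sumSubsets n F i = foldr (λ S acc → F S i + acc) 0 (allSubsets n)

-- f-polynomial of the nestohedron P(B|_S): dimension d = |S| - |(B|_S)_max|,
-- f_i = #nested collections of cardinality d - i for i ≤ d, 0 otherwise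
fNest : ∀ {n} → (Subset n → Bool) → Subset n → Poly
fNest B S i = let d = ∣ S ∣ ∸ numMax B S in
  if i ≤ᵇ d then numNested B S (d ∸ i) else 0

fExt : ∀ {n} → (Subset n → Bool) → Poly
fExt {n} B i = if i ≤ᵇ n then numExtNested B (n ∸ i) else 0

module Submission where

-- Group the extended nested collections (N, R) of B by S = ⋃ N, or by S = ∁ R. In either case N is a set M of
-- maximal elements of B|_S together with a nested collection of B|_S. For S = ⋃ N every maximal element lies in N
-- while R ranges over the subsets of ∁ S; for S = ∁ R the set M is arbitrary. Each freely chosen element either
-- is taken (one face of higher codimension) or not, so by the binomial theorem the free choices contribute
-- (t + 1)^|∁ S| resp. (t + 1)^|(B|_S)_max| to f_P(B|_S). The degree bookkeeping needs that a nested collection of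
-- B|_S has at most |S| - |(B|_S)_max| members: each member has a point lying in no smaller member.

open import Defs
open import Data.Bool using (Bool; true; false; not; _∧_; _∨_; if_then_else_; T)
import Data.Bool.Properties as BoolP
open import Data.Bool.ListAction using (all; any)
open import Data.Empty using (⊥-elim) renaming (⊥ to ⊥₀)
open import Data.Fin using (Fin; zero; suc)
open import Data.Fin.Properties using (any?)
open import Data.Fin.Subset using (Subset; ∣_∣; ∁; _∈_; _∉_; _⊆_; _∩_; _∪_; ⊥; ⁅_⁆; _-_)
open import Data.Fin.Subset.Properties
  using (∉⊥; x∈p∪q⁻; x∈p∪q⁺; x∈p∩q⁺; ⊆-antisym; p⊂q⇒∣p∣<∣q∣; ∣p∣≤n; p⊆p∪q; q⊆p∪q; _∈?_;
         x∈p∧x≢y⇒x∈p-y; x∈p⇒∣p-x∣<∣p∣; x∉p⇒x∈∁p; x∈∁p⇒x∉p; x∈⁅x⁆; x∈⁅y⁆⇒x≡y; ∣∁p∣≡n∸∣p∣; p⊆q⇒∣p∣≤∣q∣;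
         drop-there; drop-∷-⊆)
open import Data.List using (List; []; _∷_; _++_; map; length; foldr)
open import Data.List.Properties using (length-++; ++-identityʳ)
open import Data.List.Relation.Binary.Sublist.Propositional using ([]; _∷_; _∷ʳ_; ⊆-trans; lookup) renaming (_⊆_ to _⊑_)
open import Data.List.Relation.Binary.Sublist.Propositional.Properties using (length-mono-≤; to-≋)
open import Data.List.Relation.Binary.Equality.Propositional using (≋⇒≡)
open import Data.List.Relation.Unary.Any using (here; there)
open import Data.List.Membership.Propositional renaming (_∈_ to _∈L_; _∉_ to _∉L_)
open import Data.List.Membership.Propositional.Properties using (∈-map⁺; ∈-map⁻; ∈-++⁺ˡ; ∈-++⁺ʳ; ∈-++⁻)
open import Data.Nat using (ℕ; zero; suc; _+_; _∸_; _≤ᵇ_; _≡ᵇ_; _≤_; _<_; z≤n; s≤s)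
open import Data.Nat.Properties
open import Algebra.Properties.CommutativeSemigroup +-commutativeSemigroup using () renaming (interchange to +-interchange)
open import Data.Nat.Tactic.RingSolver using (solve-∀)
open import Data.Product using (_×_; _,_; Σ; ∃; proj₁; proj₂)
open import Data.Sum using (_⊎_; inj₁; inj₂; [_,_]′)
open import Data.Unit using (⊤; tt)
open import Data.Vec using ([]; _∷_; here; there)
import Data.Vec.Properties as VecP
open import Data.Vec.Properties using (∷-injective)
open import Function using (_∘_; id)
open import Relation.Binary.PropositionalEquality
open import Relation.Nullary using (¬_; contradiction)
open import Relation.Nullary.Decidable using (_×-dec_; ¬?; yes; no)

private variable A C : Set

-- Boolean reflection for lists

∧-elimˡ : ∀ {a b} → a ∧ b ≡ true → a ≡ true
∧-elimˡ {true} e = refl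

∧-elimʳ : ∀ {a b} → a ∧ b ≡ true → b ≡ true
∧-elimʳ {true} e = e

∧-intro : ∀ {a b} → a ≡ true → b ≡ true → a ∧ b ≡ true
∧-intro refl refl = refl

∨-elim : ∀ {a b} → a ∨ b ≡ true → a ≡ true ⊎ b ≡ true
∨-elim {true}  e = inj₁ refl
∨-elim {false} e = inj₂ e

∨-introˡ : ∀ {a b} → a ≡ true → a ∨ b ≡ true
∨-introˡ refl = refl

∨-introʳ : ∀ {a b} → b ≡ true → a ∨ b ≡ true
∨-introʳ {true}  e = refl
∨-introʳ {false} e = e

not-elim : ∀ {a} → not a ≡ true → a ≡ false
not-elim {false} e = refl

not-intro : ∀ {a} → a ≡ false → not a ≡ true
not-intro refl = refl

true≢false : ∀ {a} → a ≡ true → a ≡ false → ⊥₀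
true≢false refl ()

bool-ext : ∀ {a b} → (a ≡ true → b ≡ true) → (b ≡ true → a ≡ true) → a ≡ b
bool-ext {false} {false} f g = refl
bool-ext {false} {true}  f g = g refl
bool-ext {true}  {false} f g = sym (f refl)
bool-ext {true}  {true}  f g = refl

all-elim : (p : A → Bool) {xs : List A} {x : A} → all p xs ≡ true → x ∈L xs → p x ≡ true
all-elim p {x ∷ xs} e (here refl) = ∧-elimˡ e
all-elim p {x ∷ xs} e (there m)   = all-elim p (∧-elimʳ {p x} e) m

all-intro : (p : A → Bool) (xs : List A) → (∀ x → x ∈L xs → p x ≡ true) → all p xs ≡ true
all-intro p []       h = refl
all-intro p (x ∷ xs) h = ∧-intro (h x (here refl)) (all-intro p xs (λ y m → h y (there m)))

all-false : (p : A → Bool) (xs : List A) → all p xs ≡ false → ∃ λ x → x ∈L xs × p x ≡ false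
all-false p (x ∷ xs) e with p x in px
... | false = x , here refl , px
... | true  = let (y , m , py) = all-false p xs e in y , there m , py

any-elim : (p : A → Bool) (xs : List A) → any p xs ≡ true → ∃ λ x → x ∈L xs × p x ≡ true
any-elim p (x ∷ xs) e with ∨-elim {p x} e
... | inj₁ px = x , here refl , px
... | inj₂ e′ = let (y , m , py) = any-elim p xs e′ in y , there m , py

any-intro : (p : A → Bool) {xs : List A} {x : A} → x ∈L xs → p x ≡ true → any p xs ≡ true
any-intro p {x ∷ xs} (here refl) e = ∨-introˡ e
any-intro p {y ∷ xs} (there m)   e = ∨-introʳ {p y} (any-intro p m e)

any-false : (p : A → Bool) {xs : List A} {x : A} → any p xs ≡ false → x ∈L xs → p x ≡ false
any-false p {x = x} e m with p x in px
... | false = refl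
... | true  = contradiction (any-intro p m px) (λ e′ → true≢false e′ e)

∈-filterᵇ⁻ : (p : A → Bool) {xs : List A} {x : A} → x ∈L filterᵇ p xs → x ∈L xs × p x ≡ true
∈-filterᵇ⁻ p {y ∷ xs} m with p y in py
∈-filterᵇ⁻ p {y ∷ xs} (here refl) | true  = here refl , py
∈-filterᵇ⁻ p {y ∷ xs} (there m)   | true  = let (m′ , e) = ∈-filterᵇ⁻ p m in there m′ , e
∈-filterᵇ⁻ p {y ∷ xs} m           | false = let (m′ , e) = ∈-filterᵇ⁻ p m in there m′ , e

∈-filterᵇ⁺ : (p : A → Bool) {xs : List A} {x : A} → x ∈L xs → p x ≡ true → x ∈L filterᵇ p xs
∈-filterᵇ⁺ p {y ∷ xs} m e with p y in py
∈-filterᵇ⁺ p {y ∷ xs} (here refl) e | true  = here refl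
∈-filterᵇ⁺ p {y ∷ xs} (there m)   e | true  = there (∈-filterᵇ⁺ p m e)
∈-filterᵇ⁺ p {y ∷ xs} (here refl) e | false = ⊥-elim (true≢false e py)
∈-filterᵇ⁺ p {y ∷ xs} (there m)   e | false = ∈-filterᵇ⁺ p m e

filterᵇ-⊑ : (p : A → Bool) (xs : List A) → filterᵇ p xs ⊑ xs
filterᵇ-⊑ p []       = []
filterᵇ-⊑ p (x ∷ xs) with p x
... | true  = refl ∷ filterᵇ-⊑ p xs
... | false = x ∷ʳ filterᵇ-⊑ p xs

filterᵇ-mono : (p : A → Bool) {N L : List A} → N ⊑ L → filterᵇ p N ⊑ filterᵇ p L
filterᵇ-mono p [] = []
filterᵇ-mono p {x ∷ N} (refl ∷ N⊑L) with p x
... | true  = refl ∷ filterᵇ-mono p N⊑L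
... | false = filterᵇ-mono p N⊑L
filterᵇ-mono p {L = y ∷ L} (y ∷ʳ N⊑L) with p y
... | true  = y ∷ʳ filterᵇ-mono p N⊑L
... | false = filterᵇ-mono p N⊑L

⊑-filterᵇ⇒all : (p : A → Bool) {N L : List A} → N ⊑ filterᵇ p L → all p N ≡ true
⊑-filterᵇ⇒all p {N} {L} N⊑ = all-intro p N (λ x m → proj₂ (∈-filterᵇ⁻ p {L} (lookup N⊑ m)))

⊑⇒∈-sublists : {N L : List A} → N ⊑ L → N ∈L sublists L
⊑⇒∈-sublists [] = here refl
⊑⇒∈-sublists {L = x ∷ L} (refl ∷ N⊑L) = ∈-++⁺ˡ (∈-map⁺ (x ∷_) (⊑⇒∈-sublists N⊑L))
⊑⇒∈-sublists {L = x ∷ L} (x ∷ʳ N⊑L)   = ∈-++⁺ʳ (map (x ∷_) (sublists L)) (⊑⇒∈-sublists N⊑L)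

∈-sublists⇒⊑ : (L : List A) {N : List A} → N ∈L sublists L → N ⊑ L
∈-sublists⇒⊑ [] (here refl) = []
∈-sublists⇒⊑ (x ∷ L) m with ∈-++⁻ (map (x ∷_) (sublists L)) m
... | inj₁ m′ = let (N′ , m″ , e) = ∈-map⁻ (x ∷_) m′ in subst (_⊑ x ∷ L) (sym e) (refl ∷ ∈-sublists⇒⊑ L m″)
... | inj₂ m′ = x ∷ʳ ∈-sublists⇒⊑ L m′

Uniq : List A → Set
Uniq []       = ⊤
Uniq (x ∷ xs) = (x ∉L xs) × Uniq xs

⊑-Uniq : {N L : List A} → N ⊑ L → Uniq L → Uniq N
⊑-Uniq []           u         = tt
⊑-Uniq (refl ∷ N⊑L) (x∉ , u) = (λ m → x∉ (lookup N⊑L m)) , ⊑-Uniq N⊑L u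
⊑-Uniq (_ ∷ʳ N⊑L)   (_ , u)  = ⊑-Uniq N⊑L u

Uniq-++ : (xs ys : List A) → Uniq xs → Uniq ys → (∀ z → z ∈L xs → z ∉L ys) → Uniq (xs ++ ys)
Uniq-++ []       ys u         v disj = v
Uniq-++ (x ∷ xs) ys (x∉ , u) v disj =
  [ x∉ , disj x (here refl) ]′ ∘ ∈-++⁻ xs , Uniq-++ xs ys u v (λ z m → disj z (there m))

map-Uniq : (f : A → C) → (∀ {x y} → f x ≡ f y → x ≡ y) → (xs : List A) → Uniq xs → Uniq (map f xs)
map-Uniq f f-inj []       u         = tt
map-Uniq f f-inj (x ∷ xs) (x∉ , u) =
  (λ m → let (y , m′ , fx≡fy) = ∈-map⁻ f m in x∉ (subst (_∈L xs) (sym (f-inj fx≡fy)) m′)) , map-Uniq f f-inj xs u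

⊑-covering⇒≡ : {M L : List A} → M ⊑ L → Uniq L → (∀ x → x ∈L L → x ∈L M) → M ≡ L
⊑-covering⇒≡ [] u cover = refl
⊑-covering⇒≡ (refl ∷ M⊑L) (x∉ , u) cover =
  cong (_ ∷_) (⊑-covering⇒≡ M⊑L u (λ y m → drop-head (cover y (there m)) m))
  where
  drop-head : ∀ {y} → y ∈L (_ ∷ _) → y ∈L _ → y ∈L _
  drop-head (here refl) m = ⊥-elim (x∉ m)
  drop-head (there m′)  _ = m′
⊑-covering⇒≡ (x ∷ʳ M⊑L) (x∉ , u) cover = ⊥-elim (x∉ (lookup M⊑L (cover x (here refl))))

∧-rearrange : ∀ a b c d → a ∧ b ∧ c ∧ d ≡ (a ∧ d) ∧ b ∧ c
∧-rearrange false b     c     d = refl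
∧-rearrange true  false c     d = sym (BoolP.∧-zeroʳ d)
∧-rearrange true  true  false d = sym (BoolP.∧-zeroʳ d)
∧-rearrange true  true  true  d = sym (BoolP.∧-identityʳ d)

all-cong : {p q : A → Bool} (xs : List A) → (∀ x → p x ≡ q x) → all p xs ≡ all q xs
all-cong []       h = refl
all-cong (x ∷ xs) h = cong₂ _∧_ (h x) (all-cong xs h)

all-∧ : (p q : A → Bool) (xs : List A) → (all p xs ∧ all q xs) ≡ all (λ x → p x ∧ q x) xs
all-∧ p q []       = refl
all-∧ p q (x ∷ xs) = trans (∧-rearrange′ (p x) (all p xs) (q x) (all q xs)) (cong ((p x ∧ q x) ∧_) (all-∧ p q xs))
  where
  ∧-rearrange′ : ∀ a b c d → (a ∧ b) ∧ c ∧ d ≡ (a ∧ c) ∧ b ∧ d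
  ∧-rearrange′ false b c     d = refl
  ∧-rearrange′ true  b false d = BoolP.∧-zeroʳ b
  ∧-rearrange′ true  b true  d = refl

filterᵇ-all : (p : A → Bool) (xs : List A) → all p xs ≡ true → filterᵇ p xs ≡ xs
filterᵇ-all p []       e = refl
filterᵇ-all p (x ∷ xs) e rewrite ∧-elimˡ {p x} e = cong (x ∷_) (filterᵇ-all p xs (∧-elimʳ {p x} e))

filterᵇ-none : (p : A → Bool) (xs : List A) → (∀ x → x ∈L xs → p x ≡ false) → filterᵇ p xs ≡ []
filterᵇ-none p []       h = refl
filterᵇ-none p (x ∷ xs) h rewrite h x (here refl) = filterᵇ-none p xs (λ y m → h y (there m))

filterᵇ-filterᵇ : (p q : A → Bool) (xs : List A) → filterᵇ p (filterᵇ q xs) ≡ filterᵇ (λ x → p x ∧ q x) xs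
filterᵇ-filterᵇ p q []       = refl
filterᵇ-filterᵇ p q (x ∷ xs) with q x
... | true  with p x
...   | true  = cong (x ∷_) (filterᵇ-filterᵇ p q xs)
...   | false = filterᵇ-filterᵇ p q xs
filterᵇ-filterᵇ p q (x ∷ xs) | false with p x
...   | true  = filterᵇ-filterᵇ p q xs
...   | false = filterᵇ-filterᵇ p q xs

length-filterᵇ-partition : (p : A → Bool) (xs : List A) → length xs ≡ length (filterᵇ p xs) + length (filterᵇ (not ∘ p) xs)
length-filterᵇ-partition p []       = refl
length-filterᵇ-partition p (x ∷ xs) with p x
... | true  = cong suc (length-filterᵇ-partition p xs)
... | false = trans (cong suc (length-filterᵇ-partition p xs)) (sym (+-suc _ _))

T⇒≡true : ∀ {b} → T b → b ≡ true
T⇒≡true {true} _ = refl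

≡true⇒T : ∀ {b} → b ≡ true → T b
≡true⇒T refl = tt

-- Finite sums

ΣL : List A → (A → ℕ) → ℕ
ΣL []       f = 0
ΣL (x ∷ xs) f = f x + ΣL xs f

𝟙 : Bool → ℕ
𝟙 true  = 1
𝟙 false = 0

length-filterᵇ : (p : A → Bool) (xs : List A) → length (filterᵇ p xs) ≡ ΣL xs (𝟙 ∘ p)
length-filterᵇ p []       = refl
length-filterᵇ p (x ∷ xs) with p x
... | true  = cong suc (length-filterᵇ p xs)
... | false = length-filterᵇ p xs

ΣL-++ : (xs ys : List A) (f : A → ℕ) → ΣL (xs ++ ys) f ≡ ΣL xs f + ΣL ys f
ΣL-++ []       ys f = refl
ΣL-++ (x ∷ xs) ys f = trans (cong (f x +_) (ΣL-++ xs ys f)) (sym (+-assoc (f x) _ _))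

ΣL-map : (g : A → C) (xs : List A) (f : C → ℕ) → ΣL (map g xs) f ≡ ΣL xs (f ∘ g)
ΣL-map g []       f = refl
ΣL-map g (x ∷ xs) f = cong (f (g x) +_) (ΣL-map g xs f)

ΣL-cong : (xs : List A) {f g : A → ℕ} → (∀ x → f x ≡ g x) → ΣL xs f ≡ ΣL xs g
ΣL-cong []       h = refl
ΣL-cong (x ∷ xs) h = cong₂ _+_ (h x) (ΣL-cong xs h)

ΣL-+ : (xs : List A) (f g : A → ℕ) → ΣL xs (λ x → f x + g x) ≡ ΣL xs f + ΣL xs g
ΣL-+ []       f g = refl
ΣL-+ (x ∷ xs) f g = trans (cong (f x + g x +_) (ΣL-+ xs f g)) (+-interchange (f x) (g x) (ΣL xs f) (ΣL xs g))

ΣL-zero : (xs : List A) → ΣL xs (λ _ → 0) ≡ 0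
ΣL-zero []       = refl
ΣL-zero (x ∷ xs) = ΣL-zero xs

ΣL-comm : (xs : List A) (ys : List C) (f : A → C → ℕ) →
  ΣL xs (λ x → ΣL ys (f x)) ≡ ΣL ys (λ y → ΣL xs (λ x → f x y))
ΣL-comm []       ys f = sym (ΣL-zero ys)
ΣL-comm (x ∷ xs) ys f = trans (cong (ΣL ys (f x) +_) (ΣL-comm xs ys f)) (sym (ΣL-+ ys (f x) _))

if-ΣL : (c : Bool) (xs : List A) (f : A → ℕ) →
  (if c then ΣL xs f else 0) ≡ ΣL xs (λ x → if c then f x else 0)
if-ΣL true  xs f = refl
if-ΣL false xs f = sym (ΣL-zero xs)

ΣL-filterᵇ : (p : A → Bool) (xs : List A) (f : A → ℕ) →
  ΣL (filterᵇ p xs) f ≡ ΣL xs (λ x → if p x then f x else 0)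
ΣL-filterᵇ p []       f = refl
ΣL-filterᵇ p (x ∷ xs) f with p x
... | true  = cong (f x +_) (ΣL-filterᵇ p xs f)
... | false = ΣL-filterᵇ p xs f

-- Definitionally the enumeration local to numExtNested.
pairs : {X Y : Set} → List X → List Y → List (X × Y)
pairs xs ys = foldr (λ x acc → map (x ,_) ys ++ acc) [] xs

length-filterᵇ-pairs : {X Y : Set} (p : X × Y → Bool) (xs : List X) (ys : List Y) →
  length (filterᵇ p (pairs xs ys)) ≡ ΣL xs (λ x → ΣL ys (λ y → 𝟙 (p (x , y))))
length-filterᵇ-pairs p []       ys = refl
length-filterᵇ-pairs p (x ∷ xs) ys = begin
  length (filterᵇ p (map (x ,_) ys ++ pairs xs ys))
    ≡⟨ length-filterᵇ p (map (x ,_) ys ++ pairs xs ys) ⟩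
  ΣL (map (x ,_) ys ++ pairs xs ys) (𝟙 ∘ p)
    ≡⟨ ΣL-++ (map (x ,_) ys) _ _ ⟩
  ΣL (map (x ,_) ys) (𝟙 ∘ p) + ΣL (pairs xs ys) (𝟙 ∘ p)
    ≡⟨ cong₂ _+_ (ΣL-map (x ,_) ys _)
                 (trans (sym (length-filterᵇ p (pairs xs ys))) (length-filterᵇ-pairs p xs ys)) ⟩
  ΣL ys (λ y → 𝟙 (p (x , y))) + ΣL xs (λ x → ΣL ys (λ y → 𝟙 (p (x , y)))) ∎
  where open ≡-Reasoning

filterᵇ-accept : (p : A → Bool) {x : A} (xs : List A) → p x ≡ true → filterᵇ p (x ∷ xs) ≡ x ∷ filterᵇ p xs
filterᵇ-accept p xs e rewrite e = refl

filterᵇ-reject : (p : A → Bool) {x : A} (xs : List A) → p x ≡ false → filterᵇ p (x ∷ xs) ≡ filterᵇ p xs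
filterᵇ-reject p xs e rewrite e = refl

filterᵇ-++ : (p : A → Bool) (xs ys : List A) → filterᵇ p (xs ++ ys) ≡ filterᵇ p xs ++ filterᵇ p ys
filterᵇ-++ p []       ys = refl
filterᵇ-++ p (x ∷ xs) ys with p x
... | true  = cong (x ∷_) (filterᵇ-++ p xs ys)
... | false = filterᵇ-++ p xs ys

filterᵇ-all-map-∷ : (p : A → Bool) (x : A) (Ns : List (List A)) → p x ≡ true →
  filterᵇ (all p) (map (x ∷_) Ns) ≡ map (x ∷_) (filterᵇ (all p) Ns)
filterᵇ-all-map-∷ p x []       e = refl
filterᵇ-all-map-∷ p x (N ∷ Ns) e rewrite e with all p N
... | true  = cong ((x ∷ N) ∷_) (filterᵇ-all-map-∷ p x Ns e)
... | false = filterᵇ-all-map-∷ p x Ns e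

filterᵇ-all-map-∷-reject : (p : A → Bool) (x : A) (Ns : List (List A)) → p x ≡ false →
  filterᵇ (all p) (map (x ∷_) Ns) ≡ []
filterᵇ-all-map-∷-reject p x []       e = refl
filterᵇ-all-map-∷-reject p x (N ∷ Ns) e rewrite e = filterᵇ-all-map-∷-reject p x Ns e

sublists-filterᵇ : (p : A → Bool) (xs : List A) → sublists (filterᵇ p xs) ≡ filterᵇ (all p) (sublists xs)
sublists-filterᵇ p []       = refl
sublists-filterᵇ p (x ∷ xs) with p x in e
... | true  = begin
  map (x ∷_) (sublists (filterᵇ p xs)) ++ sublists (filterᵇ p xs)
    ≡⟨ cong₂ (λ Ns Ms → map (x ∷_) Ns ++ Ms) (sublists-filterᵇ p xs) (sublists-filterᵇ p xs) ⟩
  map (x ∷_) (filterᵇ (all p) (sublists xs)) ++ filterᵇ (all p) (sublists xs)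
    ≡⟨ cong (_++ _) (filterᵇ-all-map-∷ p x (sublists xs) e) ⟨
  filterᵇ (all p) (map (x ∷_) (sublists xs)) ++ filterᵇ (all p) (sublists xs)
    ≡⟨ filterᵇ-++ (all p) (map (x ∷_) (sublists xs)) _ ⟨
  filterᵇ (all p) (sublists (x ∷ xs)) ∎
  where open ≡-Reasoning
... | false = begin
  sublists (filterᵇ p xs)
    ≡⟨ sublists-filterᵇ p xs ⟩
  filterᵇ (all p) (sublists xs)
    ≡⟨ cong (_++ _) (filterᵇ-all-map-∷-reject p x (sublists xs) e) ⟨
  filterᵇ (all p) (map (x ∷_) (sublists xs)) ++ filterᵇ (all p) (sublists xs)
    ≡⟨ filterᵇ-++ (all p) (map (x ∷_) (sublists xs)) _ ⟨
  filterᵇ (all p) (sublists (x ∷ xs)) ∎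
  where open ≡-Reasoning

ΣL-sublists-filterᵇ : (p : A → Bool) (xs : List A) (f : List A → ℕ) →
  ΣL (sublists xs) (λ N → if all p N then f N else 0) ≡ ΣL (sublists (filterᵇ p xs)) f
ΣL-sublists-filterᵇ p xs f = sym (begin
  ΣL (sublists (filterᵇ p xs)) f                  ≡⟨ cong (λ Ns → ΣL Ns f) (sublists-filterᵇ p xs) ⟩
  ΣL (filterᵇ (all p) (sublists xs)) f            ≡⟨ ΣL-filterᵇ (all p) (sublists xs) f ⟩
  ΣL (sublists xs) (λ N → if all p N then f N else 0) ∎)
  where open ≡-Reasoning

ΣL-sublists-∷ : (x : A) (xs : List A) (f : List A → ℕ) →
  ΣL (sublists (x ∷ xs)) f ≡ ΣL (sublists xs) (λ N → f (x ∷ N)) + ΣL (sublists xs) f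
ΣL-sublists-∷ x xs f =
  trans (ΣL-++ (map (x ∷_) (sublists xs)) (sublists xs) f)
        (cong (_+ ΣL (sublists xs) f) (ΣL-map (x ∷_) (sublists xs) f))

ΣL-sublists-cong : (xs : List A) {f g : List A → ℕ} → (∀ N → N ⊑ xs → f N ≡ g N) →
  ΣL (sublists xs) f ≡ ΣL (sublists xs) g
ΣL-sublists-cong []       h = cong (_+ 0) (h [] [])
ΣL-sublists-cong (x ∷ xs) {f} {g} h = begin
  ΣL (sublists (x ∷ xs)) f
    ≡⟨ ΣL-sublists-∷ x xs f ⟩
  ΣL (sublists xs) (λ N → f (x ∷ N)) + ΣL (sublists xs) f
    ≡⟨ cong₂ _+_ (ΣL-sublists-cong xs (λ N N⊑xs → h (x ∷ N) (refl ∷ N⊑xs)))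
                 (ΣL-sublists-cong xs (λ N N⊑xs → h N (x ∷ʳ N⊑xs))) ⟩
  ΣL (sublists xs) (λ N → g (x ∷ N)) + ΣL (sublists xs) g
    ≡⟨ ΣL-sublists-∷ x xs g ⟨
  ΣL (sublists (x ∷ xs)) g ∎
  where open ≡-Reasoning

-- A sublist N of xs is the same as a pair of sublists of filterᵇ q xs and of filterᵇ (not ∘ q) xs.
ΣL-sublists-partition : (q : A → Bool) (xs : List A) (F : List A → ℕ) (G : List A → List A → ℕ) →
  (∀ N → N ⊑ xs → F N ≡ G (filterᵇ q N) (filterᵇ (not ∘ q) N)) →
  ΣL (sublists xs) F ≡ ΣL (sublists (filterᵇ q xs)) (λ M → ΣL (sublists (filterᵇ (not ∘ q) xs)) (G M))
ΣL-sublists-partition q [] F G h = cong (_+ 0) (trans (h [] []) (sym (+-identityʳ _)))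
ΣL-sublists-partition q (x ∷ xs) F G h with q x in e
... | true = begin
  ΣL (sublists (x ∷ xs)) F
    ≡⟨ ΣL-sublists-∷ x xs F ⟩
  ΣL (sublists xs) (λ N → F (x ∷ N)) + ΣL (sublists xs) F
    ≡⟨ cong₂ _+_ (ΣL-sublists-partition q xs (λ N → F (x ∷ N)) (λ M → G (x ∷ M)) with-x)
                 (ΣL-sublists-partition q xs F G (λ N N⊑xs → h N (x ∷ʳ N⊑xs))) ⟩
  ΣL Ms (λ M → ΣL Cs (G (x ∷ M))) + ΣL Ms (λ M → ΣL Cs (G M))
    ≡⟨ ΣL-sublists-∷ x (filterᵇ q xs) _ ⟨
  ΣL (sublists (x ∷ filterᵇ q xs)) (λ M → ΣL Cs (G M)) ∎
  where
  open ≡-Reasoning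
  Ms = sublists (filterᵇ q xs)
  Cs = sublists (filterᵇ (not ∘ q) xs)
  with-x : ∀ N → N ⊑ xs → F (x ∷ N) ≡ G (x ∷ filterᵇ q N) (filterᵇ (not ∘ q) N)
  with-x N N⊑xs = trans (h (x ∷ N) (refl ∷ N⊑xs))
                        (cong₂ G (filterᵇ-accept q N e) (filterᵇ-reject (not ∘ q) N (cong not e)))
... | false = begin
  ΣL (sublists (x ∷ xs)) F
    ≡⟨ ΣL-sublists-∷ x xs F ⟩
  ΣL (sublists xs) (λ N → F (x ∷ N)) + ΣL (sublists xs) F
    ≡⟨ cong₂ _+_ (ΣL-sublists-partition q xs (λ N → F (x ∷ N)) (λ M C → G M (x ∷ C)) with-x)
                 (ΣL-sublists-partition q xs F G (λ N N⊑xs → h N (x ∷ʳ N⊑xs))) ⟩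
  ΣL Ms (λ M → ΣL Cs (λ C → G M (x ∷ C))) + ΣL Ms (λ M → ΣL Cs (G M))
    ≡⟨ ΣL-+ Ms _ _ ⟨
  ΣL Ms (λ M → ΣL Cs (λ C → G M (x ∷ C)) + ΣL Cs (G M))
    ≡⟨ ΣL-cong Ms (λ M → ΣL-sublists-∷ x (filterᵇ (not ∘ q) xs) (G M)) ⟨
  ΣL Ms (λ M → ΣL (sublists (x ∷ filterᵇ (not ∘ q) xs)) (G M)) ∎
  where
  open ≡-Reasoning
  Ms = sublists (filterᵇ q xs)
  Cs = sublists (filterᵇ (not ∘ q) xs)
  with-x : ∀ N → N ⊑ xs → F (x ∷ N) ≡ G (filterᵇ q N) (x ∷ filterᵇ (not ∘ q) N)
  with-x N N⊑xs = trans (h (x ∷ N) (refl ∷ N⊑xs))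
                        (cong₂ G (filterᵇ-reject q N e) (filterᵇ-accept (not ∘ q) N (cong not e)))

ΣL-sublists-full : (xs : List A) (h : ℕ → ℕ) →
  ΣL (sublists xs) (λ M → if length M ≡ᵇ length xs then h (length M) else 0) ≡ h (length xs)
ΣL-sublists-full []       h = +-identityʳ _
ΣL-sublists-full (x ∷ xs) h = begin
  ΣL (sublists (x ∷ xs)) (λ M → if length M ≡ᵇ suc (length xs) then h (length M) else 0)
    ≡⟨ ΣL-sublists-∷ x xs _ ⟩
  ΣL (sublists xs) (λ M → if length M ≡ᵇ length xs then h (suc (length M)) else 0) +
  ΣL (sublists xs) (λ M → if length M ≡ᵇ suc (length xs) then h (length M) else 0)
    ≡⟨ cong₂ _+_ (ΣL-sublists-full xs (h ∘ suc))
                 (trans (ΣL-sublists-cong xs too-long) (ΣL-zero (sublists xs))) ⟩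
  h (suc (length xs)) + 0
    ≡⟨ +-identityʳ _ ⟩
  h (suc (length xs)) ∎
  where
  open ≡-Reasoning
  too-long : ∀ N → N ⊑ xs → (if length N ≡ᵇ suc (length xs) then h (length N) else 0) ≡ 0
  too-long N N⊑xs with length N ≡ᵇ suc (length xs) in e
  ... | false = refl
  ... | true  = contradiction (≡ᵇ⇒≡ _ _ (subst T (sym e) tt)) (<⇒≢ (s≤s (length-mono-≤ N⊑xs)))

if-∧ : (a b : Bool) (y : ℕ) → (if a ∧ b then y else 0) ≡ (if a then (if b then y else 0) else 0)
if-∧ true  b y = refl
if-∧ false b y = refl

if-𝟙-∧ : (c a x : Bool) → (if c then 𝟙 (a ∧ x) else 0) ≡ (if a then (if c then 𝟙 x else 0) else 0)
if-𝟙-∧ c     true  x = refl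
if-𝟙-∧ true  false x = refl
if-𝟙-∧ false false x = refl

-- Subsets of Fin n

subᵇ-⊆ : ∀ {n} (I J : Subset n) → subᵇ I J ≡ true → I ⊆ J
subᵇ-⊆ (true ∷ I) (true ∷ J)  e  here      = here
subᵇ-⊆ (a ∷ I)    (b ∷ J)     e  (there m) = there (subᵇ-⊆ I J (∧-elimʳ {not a ∨ b} e) m)

⊆-subᵇ : ∀ {n} (I J : Subset n) → I ⊆ J → subᵇ I J ≡ true
⊆-subᵇ []          []          h = refl
⊆-subᵇ (false ∷ I) (b ∷ J)     h = ⊆-subᵇ I J (drop-∷-⊆ h)
⊆-subᵇ (true ∷ I)  (true ∷ J)  h = ⊆-subᵇ I J (drop-∷-⊆ h)
⊆-subᵇ (true ∷ I)  (false ∷ J) h with h here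
... | ()

subᵇ-false : ∀ {n} (I J : Subset n) → subᵇ I J ≡ false → ∃ λ x → x ∈ I × x ∉ J
subᵇ-false []          []          ()
subᵇ-false (true ∷ I)  (false ∷ J) e = zero , here , λ ()
subᵇ-false (true ∷ I)  (true ∷ J)  e = let (x , x∈I , x∉J) = subᵇ-false I J e in suc x , there x∈I , x∉J ∘ drop-there
subᵇ-false (false ∷ I) (b ∷ J)     e = let (x , x∈I , x∉J) = subᵇ-false I J e in suc x , there x∈I , x∉J ∘ drop-there

disjᵇ-elim : ∀ {n} (I J : Subset n) {x : Fin n} → disjᵇ I J ≡ true → x ∈ I → x ∈ J → ⊥₀
disjᵇ-elim (true ∷ I)  (true ∷ J)  ()  here       here
disjᵇ-elim (true ∷ I)  (false ∷ J) e   (there m)  (there m′) = disjᵇ-elim I J e m m′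
disjᵇ-elim (false ∷ I) (b ∷ J)     e   (there m)  (there m′) = disjᵇ-elim I J e m m′

disjᵇ-intro : ∀ {n} (I J : Subset n) → (∀ {x} → x ∈ I → x ∈ J → ⊥₀) → disjᵇ I J ≡ true
disjᵇ-intro []          []          h = refl
disjᵇ-intro (true ∷ I)  (true ∷ J)  h = ⊥-elim (h here here)
disjᵇ-intro (true ∷ I)  (false ∷ J) h = disjᵇ-intro I J (λ m m′ → h (there m) (there m′))
disjᵇ-intro (false ∷ I) (true ∷ J)  h = disjᵇ-intro I J (λ m m′ → h (there m) (there m′))
disjᵇ-intro (false ∷ I) (false ∷ J) h = disjᵇ-intro I J (λ m m′ → h (there m) (there m′))

disjᵇ-false : ∀ {n} (I J : Subset n) → disjᵇ I J ≡ false → ∃ λ x → x ∈ I × x ∈ J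
disjᵇ-false []          []          ()
disjᵇ-false (true ∷ I)  (true ∷ J)  e = zero , here , here
disjᵇ-false (true ∷ I)  (false ∷ J) e = let (x , x∈I , x∈J) = disjᵇ-false I J e in suc x , there x∈I , there x∈J
disjᵇ-false (false ∷ I) (b ∷ J)     e = let (x , x∈I , x∈J) = disjᵇ-false I J e in suc x , there x∈I , there x∈J

disjᵇ-sym : ∀ {n} (I J : Subset n) → disjᵇ I J ≡ true → disjᵇ J I ≡ true
disjᵇ-sym I J e = disjᵇ-intro J I (λ m m′ → disjᵇ-elim I J e m′ m)

∈⋃⁻ : ∀ {n} (N : List (Subset n)) {x : Fin n} → x ∈ ⋃ N → ∃ λ I → I ∈L N × x ∈ I
∈⋃⁻ []      m = ⊥-elim (∉⊥ m)
∈⋃⁻ (I ∷ N) m with x∈p∪q⁻ I (⋃ N) m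
... | inj₁ x∈I = I , here refl , x∈I
... | inj₂ m′  = let (J , J∈N , x∈J) = ∈⋃⁻ N m′ in J , there J∈N , x∈J

∈⋃⁺ : ∀ {n} (N : List (Subset n)) {x : Fin n} {I : Subset n} → I ∈L N → x ∈ I → x ∈ ⋃ N
∈⋃⁺ (I ∷ N) (here refl) x∈I = x∈p∪q⁺ (inj₁ x∈I)
∈⋃⁺ (J ∷ N) (there I∈N) x∈I = x∈p∪q⁺ (inj₂ (∈⋃⁺ N I∈N x∈I))

allSubsets-complete : ∀ n (I : Subset n) → I ∈L allSubsets n
allSubsets-complete zero    []          = here refl
allSubsets-complete (suc n) (true ∷ I)  = ∈-++⁺ˡ (∈-map⁺ (true ∷_) (allSubsets-complete n I))
allSubsets-complete (suc n) (false ∷ I) =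
  ∈-++⁺ʳ (map (true ∷_) (allSubsets n)) (∈-map⁺ (false ∷_) (allSubsets-complete n I))

allSubsets-Uniq : ∀ n → Uniq (allSubsets n)
allSubsets-Uniq zero    = (λ ()) , tt
allSubsets-Uniq (suc n) =
  Uniq-++ _ _ (map-Uniq (true ∷_) (proj₂ ∘ ∷-injective) _ (allSubsets-Uniq n))
              (map-Uniq (false ∷_) (proj₂ ∘ ∷-injective) _ (allSubsets-Uniq n))
              (λ I m m′ → let (_ , _ , e) = ∈-map⁻ (true ∷_) m ; (_ , _ , e′) = ∈-map⁻ (false ∷_) m′ in
                          true≢false refl (proj₁ (∷-injective (trans (sym e) e′))))

disjᵇ-∁ : ∀ {n} (S I : Subset n) → disjᵇ (∁ S) I ≡ subᵇ I S
disjᵇ-∁ S I = bool-ext (λ e → ⊆-subᵇ I S (λ x∈I → in-S x∈I e))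
                       (λ e → disjᵇ-intro (∁ S) I (λ x∈∁S x∈I → x∈∁p⇒x∉p x∈∁S (subᵇ-⊆ I S e x∈I)))
  where
  in-S : ∀ {x} → x ∈ I → disjᵇ (∁ S) I ≡ true → x ∈ S
  in-S {x} x∈I e with x ∈? S
  ... | yes x∈S = x∈S
  ... | no  x∉S = ⊥-elim (disjᵇ-elim (∁ S) I e (x∉p⇒x∈∁p x∉S) x∈I)

-- Polynomials

mulT^ : ℕ → Poly → Poly
mulT^ zero    p i       = p i
mulT^ (suc a) p zero    = 0
mulT^ (suc a) p (suc i) = mulT^ a p i

mulT^-cong : ∀ a {p q : Poly} i → (∀ j → p j ≡ q j) → mulT^ a p i ≡ mulT^ a q i
mulT^-cong zero    i       h = h i
mulT^-cong (suc a) zero    h = refl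
mulT^-cong (suc a) (suc i) h = mulT^-cong a i h

mulT^-ΣL : (a : ℕ) (xs : List A) (f : ℕ → A → ℕ) (i : ℕ) →
  mulT^ a (λ j → ΣL xs (f j)) i ≡ ΣL xs (λ x → mulT^ a (λ j → f j x) i)
mulT^-ΣL zero    xs f i       = refl
mulT^-ΣL (suc a) xs f zero    = sym (ΣL-zero xs)
mulT^-ΣL (suc a) xs f (suc i) = mulT^-ΣL a xs f i

mulT^-if : (a : ℕ) (c : Bool) (f : Poly) (i : ℕ) →
  mulT^ a (λ j → if c then f j else 0) i ≡ (if c then mulT^ a f i else 0)
mulT^-if zero    c     f i       = refl
mulT^-if (suc a) true  f zero    = refl
mulT^-if (suc a) false f zero    = refl
mulT^-if (suc a) c     f (suc i) = mulT^-if a c f i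

mulT1-mulT^ : (p : Poly) (i : ℕ) → mulT1 p i ≡ p i + mulT^ 1 p i
mulT1-mulT^ p zero    = sym (+-identityʳ _)
mulT1-mulT^ p (suc i) = refl

mulT^-suc : (a : ℕ) (p : Poly) (i : ℕ) → mulT^ 1 (mulT^ a p) i ≡ mulT^ (suc a) p i
mulT^-suc a p zero    = refl
mulT^-suc a p (suc i) = refl

-- One step of the binomial theorem: multiplying Σ_x t^(e x) q_x by t + 1 raises each exponent by 0 or by 1.
mulT1-ΣL-mulT^ : (xs : List A) (e : A → ℕ) (q : A → Poly) (p : Poly) →
  (∀ j → p j ≡ ΣL xs (λ x → mulT^ (e x) (q x) j)) →
  ∀ i → mulT1 p i ≡ ΣL xs (λ x → mulT^ (e x) (q x) i) + ΣL xs (λ x → mulT^ (suc (e x)) (q x) i)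
mulT1-ΣL-mulT^ xs e q p p≡ i = begin
  mulT1 p i
    ≡⟨ mulT1-mulT^ p i ⟩
  p i + mulT^ 1 p i
    ≡⟨ cong₂ _+_ (p≡ i) (mulT^-cong 1 i p≡) ⟩
  ΣL xs (λ x → mulT^ (e x) (q x) i) + mulT^ 1 (λ j → ΣL xs (λ x → mulT^ (e x) (q x) j)) i
    ≡⟨ cong (ΣL xs (λ x → mulT^ (e x) (q x) i) +_)
            (trans (mulT^-ΣL 1 xs (λ j x → mulT^ (e x) (q x) j) i) (ΣL-cong xs (λ x → mulT^-suc (e x) (q x) i))) ⟩
  ΣL xs (λ x → mulT^ (e x) (q x) i) + ΣL xs (λ x → mulT^ (suc (e x)) (q x) i) ∎
  where open ≡-Reasoning

mulT1^-binomial : (xs : List A) (p : Poly) (i : ℕ) →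
  mulT1^ (length xs) p i ≡ ΣL (sublists xs) (λ M → mulT^ (length xs ∸ length M) p i)
mulT1^-binomial []       p i = sym (+-identityʳ _)
mulT1^-binomial (x ∷ xs) p i = begin
  mulT1 (mulT1^ (length xs) p) i
    ≡⟨ mulT1-ΣL-mulT^ (sublists xs) (λ M → length xs ∸ length M) (λ _ → p) _ (mulT1^-binomial xs p) i ⟩
  ΣL (sublists xs) (λ M → mulT^ (length xs ∸ length M) p i) +
  ΣL (sublists xs) (λ M → mulT^ (suc (length xs ∸ length M)) p i)
    ≡⟨ cong (ΣL (sublists xs) (λ M → mulT^ (length xs ∸ length M) p i) +_)
            (ΣL-sublists-cong xs (λ M M⊑xs → cong (λ a → mulT^ a p i) (+-∸-assoc 1 (length-mono-≤ M⊑xs)))) ⟨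
  ΣL (sublists xs) (λ M → mulT^ (length xs ∸ length M) p i) +
  ΣL (sublists xs) (λ M → mulT^ (suc (length xs) ∸ length M) p i)
    ≡⟨ ΣL-sublists-∷ x xs _ ⟨
  ΣL (sublists (x ∷ xs)) (λ M → mulT^ (suc (length xs) ∸ length M) p i) ∎
  where open ≡-Reasoning

ΣL-allSubsets-suc : ∀ n (f : Subset (suc n) → ℕ) →
  ΣL (allSubsets (suc n)) f ≡ ΣL (allSubsets n) (λ S → f (true ∷ S)) + ΣL (allSubsets n) (λ S → f (false ∷ S))
ΣL-allSubsets-suc n f =
  trans (ΣL-++ (map (true ∷_) (allSubsets n)) _ f) (cong₂ _+_ (ΣL-map _ (allSubsets n) f) (ΣL-map _ (allSubsets n) f))

mulT1^-binomial-subsets : ∀ n (C : Subset n) (p : Poly) (i : ℕ) →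
  mulT1^ ∣ C ∣ p i ≡ ΣL (allSubsets n) (λ R → if subᵇ R C then mulT^ (∣ C ∣ ∸ ∣ R ∣) p i else 0)
mulT1^-binomial-subsets zero    []          p i = sym (+-identityʳ _)
mulT1^-binomial-subsets (suc n) (false ∷ C) p i = begin
  mulT1^ ∣ C ∣ p i
    ≡⟨ mulT1^-binomial-subsets n C p i ⟩
  ΣL (allSubsets n) (λ R → if subᵇ R C then mulT^ (∣ C ∣ ∸ ∣ R ∣) p i else 0)
    ≡⟨ cong (_+ ΣC) (ΣL-zero (allSubsets n)) ⟨
  ΣL (allSubsets n) (λ _ → 0) + ΣC
    ≡⟨ ΣL-allSubsets-suc n _ ⟨
  ΣL (allSubsets (suc n)) (λ R → if subᵇ R (false ∷ C) then mulT^ (∣ C ∣ ∸ ∣ R ∣) p i else 0) ∎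
  where
  open ≡-Reasoning
  ΣC = ΣL (allSubsets n) (λ R → if subᵇ R C then mulT^ (∣ C ∣ ∸ ∣ R ∣) p i else 0)
mulT1^-binomial-subsets (suc n) (true ∷ C) p i = begin
  mulT1 (mulT1^ ∣ C ∣ p) i
    ≡⟨ mulT1-ΣL-mulT^ (allSubsets n) (λ R → ∣ C ∣ ∸ ∣ R ∣) (λ R k → if subᵇ R C then p k else 0) _ IH i ⟩
  ΣL (allSubsets n) (λ R → mulT^ (∣ C ∣ ∸ ∣ R ∣) (λ j → if subᵇ R C then p j else 0) i) +
  ΣL (allSubsets n) (λ R → mulT^ (suc (∣ C ∣ ∸ ∣ R ∣)) (λ j → if subᵇ R C then p j else 0) i)
    ≡⟨ cong₂ _+_ (ΣL-cong (allSubsets n) (λ R → mulT^-if (∣ C ∣ ∸ ∣ R ∣) (subᵇ R C) p i))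
                 (ΣL-cong (allSubsets n) (λ R → trans (mulT^-if (suc (∣ C ∣ ∸ ∣ R ∣)) (subᵇ R C) p i) (exponent R))) ⟩
  ΣL (allSubsets n) (λ R → if subᵇ R C then mulT^ (∣ C ∣ ∸ ∣ R ∣) p i else 0) +
  ΣL (allSubsets n) (λ R → if subᵇ R C then mulT^ (suc ∣ C ∣ ∸ ∣ R ∣) p i else 0)
    ≡⟨ ΣL-allSubsets-suc n _ ⟨
  ΣL (allSubsets (suc n)) (λ R → if subᵇ R (true ∷ C) then mulT^ (suc ∣ C ∣ ∸ ∣ R ∣) p i else 0) ∎
  where
  open ≡-Reasoning
  IH : ∀ j →
    mulT1^ ∣ C ∣ p j ≡ ΣL (allSubsets n) (λ R → mulT^ (∣ C ∣ ∸ ∣ R ∣) (λ k → if subᵇ R C then p k else 0) j)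
  IH j = trans (mulT1^-binomial-subsets n C p j)
                    (ΣL-cong (allSubsets n) (λ R → sym (mulT^-if (∣ C ∣ ∸ ∣ R ∣) (subᵇ R C) p j)))
  exponent : ∀ R → (if subᵇ R C then mulT^ (suc (∣ C ∣ ∸ ∣ R ∣)) p i else 0)
                 ≡ (if subᵇ R C then mulT^ (suc ∣ C ∣ ∸ ∣ R ∣) p i else 0)
  exponent R with subᵇ R C in R⊆C
  ... | true  = cong (λ a → mulT^ a p i) (sym (+-∸-assoc 1 (p⊆q⇒∣p∣≤∣q∣ (subᵇ-⊆ R C R⊆C))))
  ... | false = refl

ΣL-allSubsets-∁ : ∀ n (f : Subset n → ℕ) → ΣL (allSubsets n) f ≡ ΣL (allSubsets n) (f ∘ ∁)
ΣL-allSubsets-∁ zero    f = refl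
ΣL-allSubsets-∁ (suc n) f = begin
  ΣL (allSubsets (suc n)) f
    ≡⟨ ΣL-allSubsets-suc n f ⟩
  ΣL (allSubsets n) (λ S → f (true ∷ S)) + ΣL (allSubsets n) (λ S → f (false ∷ S))
    ≡⟨ +-comm (ΣL (allSubsets n) (λ S → f (true ∷ S))) _ ⟩
  ΣL (allSubsets n) (λ S → f (false ∷ S)) + ΣL (allSubsets n) (λ S → f (true ∷ S))
    ≡⟨ cong₂ _+_ (ΣL-allSubsets-∁ n (λ S → f (false ∷ S))) (ΣL-allSubsets-∁ n (λ S → f (true ∷ S))) ⟩
  ΣL (allSubsets n) (λ S → f (false ∷ ∁ S)) + ΣL (allSubsets n) (λ S → f (true ∷ ∁ S))
    ≡⟨ ΣL-allSubsets-suc n (f ∘ ∁) ⟨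
  ΣL (allSubsets (suc n)) (f ∘ ∁) ∎
  where open ≡-Reasoning

eqSubsetᵇ : ∀ {n} → Subset n → Subset n → Bool
eqSubsetᵇ []          []          = true
eqSubsetᵇ (true ∷ I)  (true ∷ J)  = eqSubsetᵇ I J
eqSubsetᵇ (false ∷ I) (false ∷ J) = eqSubsetᵇ I J
eqSubsetᵇ (true ∷ I)  (false ∷ J) = false
eqSubsetᵇ (false ∷ I) (true ∷ J)  = false

eqSubsetᵇ⇒≡ : ∀ {n} (I J : Subset n) → eqSubsetᵇ I J ≡ true → I ≡ J
eqSubsetᵇ⇒≡ []          []          e = refl
eqSubsetᵇ⇒≡ (true ∷ I)  (true ∷ J)  e = cong (true ∷_) (eqSubsetᵇ⇒≡ I J e)
eqSubsetᵇ⇒≡ (false ∷ I) (false ∷ J) e = cong (false ∷_) (eqSubsetᵇ⇒≡ I J e)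

eqSubsetᵇ-refl : ∀ {n} (I : Subset n) → eqSubsetᵇ I I ≡ true
eqSubsetᵇ-refl []          = refl
eqSubsetᵇ-refl (true ∷ I)  = eqSubsetᵇ-refl I
eqSubsetᵇ-refl (false ∷ I) = eqSubsetᵇ-refl I

ΣL-allSubsets-eqSubsetᵇ : ∀ n (X : Subset n) (f : Subset n → ℕ) →
  ΣL (allSubsets n) (λ S → if eqSubsetᵇ X S then f S else 0) ≡ f X
ΣL-allSubsets-eqSubsetᵇ zero    []          f = +-identityʳ _
ΣL-allSubsets-eqSubsetᵇ (suc n) (true ∷ X)  f =
  trans (ΣL-allSubsets-suc n _)
        (trans (cong₂ _+_ (ΣL-allSubsets-eqSubsetᵇ n X (λ S → f (true ∷ S))) (ΣL-zero (allSubsets n))) (+-identityʳ _))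
ΣL-allSubsets-eqSubsetᵇ (suc n) (false ∷ X) f =
  trans (ΣL-allSubsets-suc n _)
        (trans (cong (_+ ΣL (allSubsets n) (λ S → if eqSubsetᵇ X S then f (false ∷ S) else 0)) (ΣL-zero (allSubsets n)))
               (ΣL-allSubsets-eqSubsetᵇ n X (λ S → f (false ∷ S))))

-- Nested families

ssubᵇ⇒⊆ : ∀ {n} (K J : Subset n) → ssubᵇ K J ≡ true → K ⊆ J
ssubᵇ⇒⊆ K J e = subᵇ-⊆ K J (∧-elimˡ e)

ssubᵇ⇒¬⊇ : ∀ {n} (K J : Subset n) → ssubᵇ K J ≡ true → subᵇ J K ≡ false
ssubᵇ⇒¬⊇ K J e = not-elim (∧-elimʳ {subᵇ K J} e)

ssubᵇ⇒∣∣< : ∀ {n} (K J : Subset n) → ssubᵇ K J ≡ true → ∣ K ∣ < ∣ J ∣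
ssubᵇ⇒∣∣< K J e =
  let (x , x∈J , x∉K) = subᵇ-false J K (ssubᵇ⇒¬⊇ K J e) in p⊂q⇒∣p∣<∣q∣ (ssubᵇ⇒⊆ K J e , x , x∈J , x∉K)

ssubᵇ-intro : ∀ {n} (K J : Subset n) → K ⊆ J → subᵇ J K ≡ false → ssubᵇ K J ≡ true
ssubᵇ-intro K J K⊆J e = ∧-intro (⊆-subᵇ K J K⊆J) (not-intro e)

subᵇ∧≢⇒ssubᵇ : ∀ {n} (K J : Subset n) → subᵇ K J ≡ true → K ≢ J → ssubᵇ K J ≡ true
subᵇ∧≢⇒ssubᵇ K J e K≢J with subᵇ J K in e′
... | true  = ⊥-elim (K≢J (⊆-antisym (subᵇ-⊆ K J e) (subᵇ-⊆ J K e′)))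
... | false = ∧-intro e refl

length≤∣∣ : ∀ {n} (xs : List (Fin n)) (S : Subset n) → Uniq xs → (∀ x → x ∈L xs → x ∈ S) → length xs ≤ ∣ S ∣
length≤∣∣ []       S u         xs⊆S = z≤n
length≤∣∣ (x ∷ xs) S (x∉ , u) xs⊆S =
  ≤-trans (s≤s (length≤∣∣ xs (S - x) u xs⊆S-x)) (x∈p⇒∣p-x∣<∣p∣ (xs⊆S x (here refl)))
  where
  xs⊆S-x : ∀ y → y ∈L xs → y ∈ S - x
  xs⊆S-x y m = x∈p∧x≢y⇒x∈p-y (xs⊆S y (there m)) (λ { refl → x∉ m })

pairwiseDisjᵇ-intro : ∀ {n} (P : List (Subset n)) → Uniq P →
  (∀ K K′ → K ∈L P → K′ ∈L P → K ≢ K′ → disjᵇ K K′ ≡ true) → pairwiseDisjᵇ P ≡ true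
pairwiseDisjᵇ-intro []      u         h = refl
pairwiseDisjᵇ-intro (I ∷ M) (I∉ , u) h =
  ∧-intro (all-intro (disjᵇ I) M (λ K m → h I K (here refl) (there m) (λ { refl → I∉ m })))
          (pairwiseDisjᵇ-intro M u (λ K K′ m m′ → h K K′ (there m) (there m′)))

pairwiseDisjᵇ-partner : ∀ {n} (P : List (Subset n)) {K : Subset n} → pairwiseDisjᵇ P ≡ true → 2 ≤ length P →
  K ∈L P → ∃ λ K′ → K′ ∈L P × disjᵇ K K′ ≡ true
pairwiseDisjᵇ-partner (I ∷ [])    e (s≤s ()) _
pairwiseDisjᵇ-partner (I ∷ J ∷ P) e _ (here refl) = J , there (here refl) , ∧-elimˡ (∧-elimˡ e)
pairwiseDisjᵇ-partner (I ∷ J ∷ P) {K} e _ (there m) = I , here refl , disjᵇ-sym I K (all-elim (disjᵇ I) (∧-elimˡ e) m)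

nestedOrDisjᵇ : ∀ {n} → Subset n → Subset n → Bool
nestedOrDisjᵇ I J = subᵇ I J ∨ subᵇ J I ∨ disjᵇ I J

nestedOrDisjᵇ-elim : ∀ {n} (I J : Subset n) → nestedOrDisjᵇ I J ≡ true →
  subᵇ I J ≡ true ⊎ subᵇ J I ≡ true ⊎ disjᵇ I J ≡ true
nestedOrDisjᵇ-elim I J e with ∨-elim {subᵇ I J} e
... | inj₁ I⊆J = inj₁ I⊆J
... | inj₂ e′  = inj₂ (∨-elim e′)

pairwiseNDᵇ-elim : ∀ {n} (N : List (Subset n)) {I J : Subset n} → pairwiseNDᵇ N ≡ true → I ∈L N → J ∈L N →
  nestedOrDisjᵇ I J ≡ true
pairwiseNDᵇ-elim N {I} e I∈N J∈N = all-elim (nestedOrDisjᵇ I) (all-elim (λ I → all (nestedOrDisjᵇ I) N) e I∈N) J∈N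

pairwiseNDᵇ-intro : ∀ {n} (N : List (Subset n)) → (∀ I J → I ∈L N → J ∈L N → nestedOrDisjᵇ I J ≡ true) →
  pairwiseNDᵇ N ≡ true
pairwiseNDᵇ-intro N h = all-intro _ N (λ I I∈N → all-intro _ N (λ J J∈N → h I J I∈N J∈N))

nestedOrDisjᵇ-sym : ∀ {n} (I J : Subset n) → nestedOrDisjᵇ I J ≡ true → nestedOrDisjᵇ J I ≡ true
nestedOrDisjᵇ-sym I J e with ∨-elim {subᵇ I J} e
... | inj₁ I⊆J = ∨-introʳ {subᵇ J I} (∨-introˡ I⊆J)
... | inj₂ e′ with ∨-elim {subᵇ J I} e′
...   | inj₁ J⊆I = ∨-introˡ J⊆I
...   | inj₂ disj = ∨-introʳ {subᵇ J I} (∨-introʳ {subᵇ I J} (disjᵇ-sym I J disj))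

violatesUnionᵇ : ∀ {n} → (Subset n → Bool) → List (Subset n) → Bool
violatesUnionᵇ B P = (2 ≤ᵇ length P) ∧ pairwiseDisjᵇ P ∧ B (⋃ P)

unionCondᵇ-elim : ∀ {n} (B : Subset n → Bool) {N P : List (Subset n)} → unionCondᵇ B N ≡ true → P ⊑ N →
  violatesUnionᵇ B P ≡ false
unionCondᵇ-elim B e P⊑N = not-elim (all-elim (λ M → not (violatesUnionᵇ B M)) e (⊑⇒∈-sublists P⊑N))

unionCondᵇ-intro : ∀ {n} (B : Subset n → Bool) (N : List (Subset n)) →
  (∀ P → P ⊑ N → violatesUnionᵇ B P ≡ false) → unionCondᵇ B N ≡ true
unionCondᵇ-intro B N h = all-intro _ (sublists N) (λ P m → not-intro (h P (∈-sublists⇒⊑ N m)))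

violatesUnionᵇ-elim : ∀ {n} (B : Subset n → Bool) (P : List (Subset n)) → violatesUnionᵇ B P ≡ true →
  2 ≤ length P × pairwiseDisjᵇ P ≡ true × B (⋃ P) ≡ true
violatesUnionᵇ-elim B P e =
  ≤ᵇ⇒≤ 2 (length P) (≡true⇒T (∧-elimˡ e)) ,
  ∧-elimˡ (∧-elimʳ {2 ≤ᵇ length P} e) ,
  ∧-elimʳ {pairwiseDisjᵇ P} (∧-elimʳ {2 ≤ᵇ length P} e)

-- The two conditions on a nested collection that do not mention maximal elements.
nestedCondᵇ : ∀ {n} → (Subset n → Bool) → List (Subset n) → Bool
nestedCondᵇ B N = pairwiseNDᵇ N ∧ unionCondᵇ B N

nestedCondᵇ-⊑ : ∀ {n} (B : Subset n → Bool) {M N : List (Subset n)} → M ⊑ N →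
  nestedCondᵇ B N ≡ true → nestedCondᵇ B M ≡ true
nestedCondᵇ-⊑ B {M} {N} M⊑N e = ∧-intro
  (pairwiseNDᵇ-intro M (λ I J I∈M J∈M → pairwiseNDᵇ-elim N (∧-elimˡ e) (lookup M⊑N I∈M) (lookup M⊑N J∈M)))
  (unionCondᵇ-intro B M (λ P P⊑M → unionCondᵇ-elim B (∧-elimʳ {pairwiseNDᵇ N} e) (⊆-trans P⊑M M⊑N)))

-- A nested family N of a building set B has at most |S| members if they all lie in B|_S: each J ∈ N has a
-- point lying in no smaller member of N, and distinct members have distinct such points.
module NestedBound {n : ℕ} (B : Subset n → Bool) (hB : IsBuildingSet B) (N : List (Subset n)) (N-Uniq : Uniq N)
                   (N-nd : pairwiseNDᵇ N ≡ true) (N-union : unionCondᵇ B N ≡ true) where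

  Covered : Subset n → Set
  Covered J = ∀ {x} → x ∈ J → ∃ λ K → K ∈L N × x ∈ K × ssubᵇ K J ≡ true

  -- If J ∈ B were covered, the maximal members of N properly inside J would be ≥ 2 disjoint members of N with union J.
  module _ (J : Subset n) (BJ : B J ≡ true) (cover : Covered J) where

    maximalBelowᵇ : Subset n → Bool
    maximalBelowᵇ K = ssubᵇ K J ∧ not (any (λ K′ → ssubᵇ K K′ ∧ ssubᵇ K′ J) N)

    P = filterᵇ maximalBelowᵇ N

    P-above : ∀ k {x} K → K ∈L N → x ∈ K → ssubᵇ K J ≡ true → n ∸ ∣ K ∣ < k →
      ∃ λ K′ → K′ ∈L P × x ∈ K′
    P-above (suc k) K K∈N x∈K K⊂J bound with any (λ K′ → ssubᵇ K K′ ∧ ssubᵇ K′ J) N in e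
    ... | false = K , ∈-filterᵇ⁺ maximalBelowᵇ K∈N (∧-intro K⊂J (not-intro e)) , x∈K
    ... | true  = let (K₁ , K₁∈N , K⊂K₁⊂J) = any-elim (λ K′ → ssubᵇ K K′ ∧ ssubᵇ K′ J) N e
                      K⊂K₁ = ∧-elimˡ K⊂K₁⊂J in
      P-above k K₁ K₁∈N (ssubᵇ⇒⊆ K K₁ K⊂K₁ x∈K) (∧-elimʳ {ssubᵇ K K₁} K⊂K₁⊂J)
              (<-≤-trans (∸-monoʳ-< (ssubᵇ⇒∣∣< K K₁ K⊂K₁) (∣p∣≤n K₁)) (≤-pred bound))

    ⋃P≡J : ⋃ P ≡ J
    ⋃P≡J = ⊆-antisym ⋃P⊆J J⊆⋃P
      where
      ⋃P⊆J : ⋃ P ⊆ J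
      ⋃P⊆J x∈⋃P = let (K , K∈P , x∈K) = ∈⋃⁻ P x∈⋃P in
                  ssubᵇ⇒⊆ K J (∧-elimˡ (proj₂ (∈-filterᵇ⁻ maximalBelowᵇ {N} K∈P))) x∈K
      J⊆⋃P : J ⊆ ⋃ P
      J⊆⋃P x∈J = let (K , K∈N , x∈K , K⊂J) = cover x∈J
                     (K′ , K′∈P , x∈K′) = P-above (suc (n ∸ ∣ K ∣)) K K∈N x∈K K⊂J ≤-refl in
                 ∈⋃⁺ P K′∈P x∈K′

    P-pairwiseDisj : pairwiseDisjᵇ P ≡ true
    P-pairwiseDisj = pairwiseDisjᵇ-intro P (⊑-Uniq (filterᵇ-⊑ maximalBelowᵇ N) N-Uniq) disj
      where
      not-inside : ∀ K K′ → K ∈L P → K′ ∈L P → subᵇ K K′ ≡ true → K ≢ K′ → ⊥₀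
      not-inside K K′ K∈P K′∈P e K≢K′ =
        let (K∈N , K-max) = ∈-filterᵇ⁻ maximalBelowᵇ {N} K∈P
            (K′∈N , K′-max) = ∈-filterᵇ⁻ maximalBelowᵇ {N} K′∈P in
        true≢false (any-intro (λ K″ → ssubᵇ K K″ ∧ ssubᵇ K″ J) K′∈N
                              (∧-intro (subᵇ∧≢⇒ssubᵇ K K′ e K≢K′) (∧-elimˡ K′-max)))
                   (not-elim (∧-elimʳ {ssubᵇ K J} K-max))
      disj : ∀ K K′ → K ∈L P → K′ ∈L P → K ≢ K′ → disjᵇ K K′ ≡ true
      disj K K′ K∈P K′∈P K≢K′
        with nestedOrDisjᵇ-elim K K′ (pairwiseNDᵇ-elim N N-nd (proj₁ (∈-filterᵇ⁻ maximalBelowᵇ {N} K∈P))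
                                                              (proj₁ (∈-filterᵇ⁻ maximalBelowᵇ {N} K′∈P)))
      ... | inj₁ e        = ⊥-elim (not-inside K K′ K∈P K′∈P e K≢K′)
      ... | inj₂ (inj₁ e) = ⊥-elim (not-inside K′ K K′∈P K∈P e (K≢K′ ∘ sym))
      ... | inj₂ (inj₂ e) = e

    2≤length-P : 2 ≤ length P
    2≤length-P = at-least-two P refl
      where
      at-least-two : (Q : List (Subset n)) → Q ≡ P → 2 ≤ length Q
      at-least-two []           Q≡P = let (x , x∈J) = proj₁ hB J BJ in
                                      ⊥-elim (∉⊥ (subst (x ∈_) (trans (sym ⋃P≡J) (cong ⋃ (sym Q≡P))) x∈J))
      at-least-two (K ∷ [])     Q≡P = ⊥-elim (true≢false (⊆-subᵇ J K J⊆K) (ssubᵇ⇒¬⊇ K J (∧-elimˡ K-max)))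
        where
        K-max = proj₂ (∈-filterᵇ⁻ maximalBelowᵇ {N} (subst (K ∈L_) Q≡P (here refl)))
        J⊆K : J ⊆ K
        J⊆K x∈J with x∈p∪q⁻ K ⊥ (subst (_ ∈_) (trans (sym ⋃P≡J) (cong ⋃ (sym Q≡P))) x∈J)
        ... | inj₁ x∈K = x∈K
        ... | inj₂ x∈⊥ = ⊥-elim (∉⊥ x∈⊥)
      at-least-two (K ∷ K′ ∷ Q) Q≡P = s≤s (s≤s z≤n)

    P-violatesUnion : violatesUnionᵇ B P ≡ true
    P-violatesUnion =
      ∧-intro (T⇒≡true (≤⇒≤ᵇ 2≤length-P)) (∧-intro P-pairwiseDisj (subst (λ U → B U ≡ true) (sym ⋃P≡J) BJ))

  ¬Covered : (J : Subset n) → B J ≡ true → ¬ Covered J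
  ¬Covered J BJ cover =
    true≢false (P-violatesUnion J BJ cover) (unionCondᵇ-elim B N-union (filterᵇ-⊑ (maximalBelowᵇ J BJ cover) N))

  PrivatePoint : Subset n → Fin n → Set
  PrivatePoint J x = x ∈ J × (∀ K → K ∈L N → ssubᵇ K J ≡ true → x ∉ K)

  privatePoint : (J : Subset n) → B J ≡ true → Σ (Fin n) (PrivatePoint J)
  privatePoint J BJ with any? (λ x → (x ∈? J) ×-dec ¬? (x ∈? ⋃ (filterᵇ (λ K → ssubᵇ K J) N)))
  ... | yes (x , x∈J , x∉⋃) =
    x , x∈J , (λ K K∈N K⊂J x∈K → x∉⋃ (∈⋃⁺ _ (∈-filterᵇ⁺ (λ K → ssubᵇ K J) K∈N K⊂J) x∈K))
  ... | no ¬private = ⊥-elim (¬Covered J BJ cover)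
    where
    cover : Covered J
    cover {x} x∈J with x ∈? ⋃ (filterᵇ (λ K → ssubᵇ K J) N)
    ... | no  x∉⋃ = ⊥-elim (¬private (x , x∈J , x∉⋃))
    ... | yes x∈⋃ = let (K , K∈ , x∈K) = ∈⋃⁻ _ x∈⋃ ; (K∈N , K⊂J) = ∈-filterᵇ⁻ (λ K → ssubᵇ K J) K∈ in
                    K , K∈N , x∈K , K⊂J

  PrivatePoint-injective : ∀ {J J′ x} → J ∈L N → J′ ∈L N → PrivatePoint J x → PrivatePoint J′ x → J ≡ J′
  PrivatePoint-injective {J} {J′} J∈N J′∈N (x∈J , privJ) (x∈J′ , privJ′)
    with nestedOrDisjᵇ-elim J J′ (pairwiseNDᵇ-elim N N-nd J∈N J′∈N)
  ... | inj₁ J⊆J′ with subᵇ J′ J in e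
  ...   | true  = ⊆-antisym (subᵇ-⊆ J J′ J⊆J′) (subᵇ-⊆ J′ J e)
  ...   | false = ⊥-elim (privJ′ J J∈N (ssubᵇ-intro J J′ (subᵇ-⊆ J J′ J⊆J′) e) x∈J)
  PrivatePoint-injective {J} {J′} J∈N J′∈N (x∈J , privJ) (x∈J′ , privJ′) | inj₂ (inj₁ J′⊆J) with subᵇ J J′ in e
  ...   | true  = ⊆-antisym (subᵇ-⊆ J J′ e) (subᵇ-⊆ J′ J J′⊆J)
  ...   | false = ⊥-elim (privJ J′ J′∈N (ssubᵇ-intro J′ J (subᵇ-⊆ J′ J J′⊆J) e) x∈J′)
  PrivatePoint-injective {J} {J′} J∈N J′∈N (x∈J , _) (x∈J′ , _) | inj₂ (inj₂ disj) =
    ⊥-elim (disjᵇ-elim J J′ disj x∈J x∈J′)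

  privatePoints : (M : List (Subset n)) → (∀ J → J ∈L M → Σ (Fin n) (PrivatePoint J)) → List (Fin n)
  privatePoints []      pt = []
  privatePoints (J ∷ M) pt = proj₁ (pt J (here refl)) ∷ privatePoints M (λ J′ m → pt J′ (there m))

  length-privatePoints : (M : List (Subset n)) (pt : ∀ J → J ∈L M → Σ (Fin n) (PrivatePoint J)) →
    length (privatePoints M pt) ≡ length M
  length-privatePoints []      pt = refl
  length-privatePoints (J ∷ M) pt = cong suc (length-privatePoints M _)

  ∈-privatePoints⁻ : (M : List (Subset n)) (pt : ∀ J → J ∈L M → Σ (Fin n) (PrivatePoint J)) →
    ∀ {y} → y ∈L privatePoints M pt → ∃ λ J → J ∈L M × PrivatePoint J y
  ∈-privatePoints⁻ (J ∷ M) pt (here refl) = J , here refl , proj₂ (pt J (here refl))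
  ∈-privatePoints⁻ (J ∷ M) pt (there m)   = let (J′ , J′∈M , priv) = ∈-privatePoints⁻ M _ m in J′ , there J′∈M , priv

  privatePoints-Uniq : (M : List (Subset n)) (pt : ∀ J → J ∈L M → Σ (Fin n) (PrivatePoint J)) → Uniq M →
    (∀ J → J ∈L M → J ∈L N) → Uniq (privatePoints M pt)
  privatePoints-Uniq []      pt u         M⊆N = tt
  privatePoints-Uniq (J ∷ M) pt (J∉ , u) M⊆N = fresh , privatePoints-Uniq M _ u (λ J′ m → M⊆N J′ (there m))
    where
    fresh : proj₁ (pt J (here refl)) ∉L privatePoints M (λ J′ m → pt J′ (there m))
    fresh m = let (J′ , J′∈M , priv) = ∈-privatePoints⁻ M _ m in
      J∉ (subst (_∈L M) (sym (PrivatePoint-injective (M⊆N J (here refl)) (M⊆N J′ (there J′∈M))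
                                                    (proj₂ (pt J (here refl))) priv)) J′∈M)

  length≤∣S∣ : (S : Subset n) → all (inRestrᵇ B S) N ≡ true → length N ≤ ∣ S ∣
  length≤∣S∣ S N⊆BS = subst (_≤ ∣ S ∣) (length-privatePoints N pt)
    (length≤∣∣ (privatePoints N pt) S (privatePoints-Uniq N pt N-Uniq (λ J m → m)) points⊆S)
    where
    pt : ∀ J → J ∈L N → Σ (Fin n) (PrivatePoint J)
    pt J J∈N = privatePoint J (∧-elimˡ (all-elim (inRestrᵇ B S) N⊆BS J∈N))
    points⊆S : ∀ y → y ∈L privatePoints N pt → y ∈ S
    points⊆S y m = let (J , J∈N , y∈J , _) = ∈-privatePoints⁻ N pt m in
      subᵇ-⊆ J S (∧-elimʳ {B J} (all-elim (inRestrᵇ B S) N⊆BS J∈N)) y∈J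

-- The restriction B|_S

module Restriction {n : ℕ} (B : Subset n → Bool) (hB : IsBuildingSet B) (S : Subset n) where

  open import Data.List.Membership.DecPropositional (λ (I J : Subset n) → VecP.≡-dec BoolP._≟_ I J)
    using () renaming (_∈?_ to _∈L?_)

  inR isMax notMax : Subset n → Bool
  inR    = inRestrᵇ B S
  isMax  = isMaxᵇ B S
  notMax = not ∘ isMax

  maxima : List (Subset n)
  maxima = filterᵇ isMax (allSubsets n)

  nonMaxima candidates : List (Subset n)
  nonMaxima  = filterᵇ notMax (allSubsets n)
  candidates = filterᵇ (λ I → inR I ∧ not (isMax I)) (allSubsets n)

  inR⇒B : ∀ {I} → inR I ≡ true → B I ≡ true
  inR⇒B = ∧-elimˡ

  inR⇒⊆S : ∀ {I} → inR I ≡ true → I ⊆ S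
  inR⇒⊆S {I} e = subᵇ-⊆ I S (∧-elimʳ {B I} e)

  inR-intro : ∀ {I} → B I ≡ true → I ⊆ S → inR I ≡ true
  inR-intro {I} BI I⊆S = ∧-intro BI (⊆-subᵇ I S I⊆S)

  isMax⇒inR : ∀ {I} → isMax I ≡ true → inR I ≡ true
  isMax⇒inR = ∧-elimˡ

  isMax-maximal : ∀ {K J} → isMax K ≡ true → inR J ≡ true → K ⊆ J → J ⊆ K
  isMax-maximal {K} {J} K-max J-in K⊆J with subᵇ J K in J⊆K
  ... | true  = subᵇ-⊆ J K J⊆K
  ... | false = ⊥-elim (true≢false (∧-intro J-in (ssubᵇ-intro K J K⊆J J⊆K)) no-larger)
    where
    no-larger : (inR J ∧ ssubᵇ K J) ≡ false
    no-larger = any-false (λ J → inR J ∧ ssubᵇ K J) (not-elim (∧-elimʳ {inR K} K-max)) (allSubsets-complete n J)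

  ¬isMax⇒⊂ : ∀ {K} → inR K ≡ true → isMax K ≡ false → ∃ λ J → inR J ≡ true × ssubᵇ K J ≡ true
  ¬isMax⇒⊂ {K} K-in K-max with any (λ J → inR J ∧ ssubᵇ K J) (allSubsets n) in e
  ... | false = ⊥-elim (true≢false (∧-intro K-in refl) K-max)
  ... | true  = let (J , _ , J-in∧K⊂J) = any-elim (λ J → inR J ∧ ssubᵇ K J) (allSubsets n) e in
                J , ∧-elimˡ J-in∧K⊂J , ∧-elimʳ {inR J} J-in∧K⊂J

  isMax-above : ∀ {I} → inR I ≡ true → ∃ λ K → isMax K ≡ true × I ⊆ K
  isMax-above {I} I-in = climb (suc (n ∸ ∣ I ∣)) I-in ≤-refl
    where
    climb : ∀ k {J} → inR J ≡ true → n ∸ ∣ J ∣ < k → ∃ λ K → isMax K ≡ true × J ⊆ K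
    climb (suc k) {J} J-in bound with isMax J in J-max
    ... | true  = J , J-max , id
    ... | false = let (J′ , J′-in , J⊂J′) = ¬isMax⇒⊂ J-in J-max
                      smaller = <-≤-trans (∸-monoʳ-< (ssubᵇ⇒∣∣< J J′ J⊂J′) (∣p∣≤n J′)) (≤-pred bound)
                      (K , K-max , J′⊆K) = climb k J′-in smaller in
                  K , K-max , J′⊆K ∘ ssubᵇ⇒⊆ J J′ J⊂J′

  inR-∪ : ∀ {I J x} → inR I ≡ true → inR J ≡ true → x ∈ I → x ∈ J → inR (I ∪ J) ≡ true
  inR-∪ {I} {J} {x} I-in J-in x∈I x∈J =
    inR-intro (proj₂ (proj₂ hB) I J (inR⇒B I-in) (inR⇒B J-in) (x , x∈p∩q⁺ (x∈I , x∈J)))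
              ([ inR⇒⊆S I-in , inR⇒⊆S J-in ]′ ∘ x∈p∪q⁻ I J)

  meets-isMax⇒⊆ : ∀ {K I x} → isMax K ≡ true → inR I ≡ true → x ∈ I → x ∈ K → I ⊆ K
  meets-isMax⇒⊆ {K} {I} K-max I-in x∈I x∈K y∈I =
    isMax-maximal K-max (inR-∪ I-in (isMax⇒inR K-max) x∈I x∈K) (q⊆p∪q I K) (p⊆p∪q K y∈I)

  ⋃⊆S : (P : List (Subset n)) → all inR P ≡ true → ⋃ P ⊆ S
  ⋃⊆S P P-in x∈⋃P = let (I , I∈P , x∈I) = ∈⋃⁻ P x∈⋃P in inR⇒⊆S (all-elim inR P-in I∈P) x∈I

  -- A maximal element of B|_S meets no other member of B|_S without containing it.
  pairwiseNDᵇ-addMaxima : (N : List (Subset n)) → all inR N ≡ true → pairwiseNDᵇ (filterᵇ notMax N) ≡ true →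
    pairwiseNDᵇ N ≡ true
  pairwiseNDᵇ-addMaxima N N-in nd = pairwiseNDᵇ-intro N nestedOrDisj
    where
    inside-max : ∀ {I J} → inR I ≡ true → isMax J ≡ true → nestedOrDisjᵇ I J ≡ true
    inside-max {I} {J} I-in J-max with disjᵇ I J in I∩J
    ... | true  = ∨-introʳ {subᵇ I J} (∨-introʳ {subᵇ J I} refl)
    ... | false = let (x , x∈I , x∈J) = disjᵇ-false I J I∩J in
                  ∨-introˡ (⊆-subᵇ I J (meets-isMax⇒⊆ J-max I-in x∈I x∈J))
    nestedOrDisj : ∀ I J → I ∈L N → J ∈L N → nestedOrDisjᵇ I J ≡ true
    nestedOrDisj I J I∈N J∈N with isMax I in I-max | isMax J in J-max
    ... | _     | true  = inside-max (all-elim inR N-in I∈N) J-max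
    ... | true  | false = nestedOrDisjᵇ-sym J I (inside-max (all-elim inR N-in J∈N) I-max)
    ... | false | false = pairwiseNDᵇ-elim (filterᵇ notMax N) nd (∈-filterᵇ⁺ notMax I∈N (not-intro I-max))
                                                                  (∈-filterᵇ⁺ notMax J∈N (not-intro J-max))

  -- If P contains a maximal K and ⋃ P ∈ B, then ⋃ P = K, which leaves no room for a member disjoint from K.
  unionCondᵇ-addMaxima : (N : List (Subset n)) → all inR N ≡ true → unionCondᵇ B (filterᵇ notMax N) ≡ true →
    unionCondᵇ B N ≡ true
  unionCondᵇ-addMaxima N N-in uc = unionCondᵇ-intro B N no-violation
    where
    no-violation : ∀ P → P ⊑ N → violatesUnionᵇ B P ≡ false
    no-violation P P⊑N with all notMax P in P-notMax
    ... | true  = unionCondᵇ-elim B uc (subst (_⊑ filterᵇ notMax N) (filterᵇ-all notMax P P-notMax) (filterᵇ-mono notMax P⊑N))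
    ... | false with violatesUnionᵇ B P in violates
    ...   | false = refl
    ...   | true  = ⊥-elim (disjᵇ-elim K K′ K∩K′ (⋃P⊆K (∈⋃⁺ P K′∈P y∈K′)) y∈K′)
      where
      P-in : all inR P ≡ true
      P-in = all-intro inR P (λ I I∈P → all-elim inR N-in (lookup P⊑N I∈P))
      K-witness = all-false notMax P P-notMax
      K = proj₁ K-witness
      K∈P = proj₁ (proj₂ K-witness)
      K-max : isMax K ≡ true
      K-max with isMax K | proj₂ (proj₂ K-witness)
      ... | true | _ = refl
      P-violation = violatesUnionᵇ-elim B P violates
      ⋃P⊆K : ⋃ P ⊆ K
      ⋃P⊆K = isMax-maximal K-max (inR-intro (proj₂ (proj₂ P-violation)) (⋃⊆S P P-in)) (∈⋃⁺ P K∈P)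
      K′-witness = pairwiseDisjᵇ-partner P (proj₁ (proj₂ P-violation)) (proj₁ P-violation) K∈P
      K′ = proj₁ K′-witness
      K′∈P = proj₁ (proj₂ K′-witness)
      K∩K′ = proj₂ (proj₂ K′-witness)
      y∈K′ = proj₂ (proj₁ hB K′ (inR⇒B (all-elim inR P-in K′∈P)))

  nestedCondᵇ-addMaxima : (N : List (Subset n)) → all inR N ≡ true → nestedCondᵇ B (filterᵇ notMax N) ≡ true →
    nestedCondᵇ B N ≡ true
  nestedCondᵇ-addMaxima N N-in e =
    ∧-intro (pairwiseNDᵇ-addMaxima N N-in (∧-elimˡ e))
            (unionCondᵇ-addMaxima N N-in (∧-elimʳ {pairwiseNDᵇ (filterᵇ notMax N)} e))

  allSubsets-⊑-Uniq : ∀ {N} → N ⊑ allSubsets n → Uniq N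
  allSubsets-⊑-Uniq N⊑ = ⊑-Uniq N⊑ (allSubsets-Uniq n)

  -- Otherwise the members of N meeting K, which lie inside K by maximality, are proper subsets covering K.
  isMax-∈-covering : ∀ {K} (N : List (Subset n)) → Uniq N → isMax K ≡ true → ⋃ N ≡ S → all B N ≡ true →
    nestedCondᵇ B N ≡ true → K ∈L N
  isMax-∈-covering {K} N N-Uniq K-max ⋃N≡S N-B nc with K ∈L? N
  ... | yes K∈N = K∈N
  ... | no  K∉N = ⊥-elim (¬Covered K (inR⇒B (isMax⇒inR K-max)) cover)
    where
    open NestedBound B hB N N-Uniq (∧-elimˡ nc) (∧-elimʳ {pairwiseNDᵇ N} nc) using (Covered; ¬Covered)
    proper : ∀ {J} → J ∈L N → J ⊆ K → ssubᵇ J K ≡ true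
    proper {J} J∈N J⊆K with subᵇ K J in K⊆J
    ... | true  = ⊥-elim (K∉N (subst (_∈L N) (⊆-antisym J⊆K (subᵇ-⊆ K J K⊆J)) J∈N))
    ... | false = ∧-intro (⊆-subᵇ J K J⊆K) refl
    cover : Covered K
    cover {x} x∈K =
      let (J , J∈N , x∈J) = ∈⋃⁻ N (subst (x ∈_) (sym ⋃N≡S) (inR⇒⊆S (isMax⇒inR K-max) x∈K))
          J-in = inR-intro (all-elim B N-B J∈N) (λ y∈J → subst (_ ∈_) ⋃N≡S (∈⋃⁺ N J∈N y∈J)) in
      J , J∈N , x∈J , proper J∈N (meets-isMax⇒⊆ K-max J-in x∈J x∈K)

  inR-nonMaxima : (N : List (Subset n)) → all inR (filterᵇ notMax N) ≡ true → ∀ {I} → I ∈L N → inR I ≡ true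
  inR-nonMaxima N e {I} I∈N with isMax I in I-max
  ... | true  = isMax⇒inR I-max
  ... | false = all-elim inR e (∈-filterᵇ⁺ notMax I∈N (not-intro I-max))

  -- An extended nested collection (N, R) with ⋃ N = S consists of all maximal elements of B|_S, an arbitrary
  -- R ⊆ ∁ S, and a nested collection of B|_S.
  coveringShapeᵇ : List (Subset n) → Subset n → Bool
  coveringShapeᵇ N R =
    (length (filterᵇ isMax N) ≡ᵇ length maxima) ∧ subᵇ R (∁ S) ∧ all inR (filterᵇ notMax N) ∧ nestedCondᵇ B (filterᵇ notMax N)

  coveringExtNested⇒ : (N : List (Subset n)) → N ⊑ allSubsets n → (R : Subset n) →
    (eqSubsetᵇ (⋃ N) S ∧ isExtNestedᵇ B N R) ≡ true →
    coveringShapeᵇ N R ≡ true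
  coveringExtNested⇒ N N⊑ R e =
    ∧-intro all-maxima (∧-intro R⊆∁S (∧-intro (all-intro inR _ (λ I m → all-elim inR N-in (lookup (filterᵇ-⊑ notMax N) m)))
                                              (nestedCondᵇ-⊑ B (filterᵇ-⊑ notMax N) nc)))
    where
    ⋃N≡S : ⋃ N ≡ S
    ⋃N≡S = eqSubsetᵇ⇒≡ _ _ (∧-elimˡ e)
    ext = ∧-elimʳ {eqSubsetᵇ (⋃ N) S} e
    N-B = ∧-elimˡ ext
    nc : nestedCondᵇ B N ≡ true
    nc = ∧-intro (∧-elimˡ {pairwiseNDᵇ N} (∧-elimʳ {all B N} ext))
                 (∧-elimˡ {unionCondᵇ B N} (∧-elimʳ {pairwiseNDᵇ N} (∧-elimʳ {all B N} ext)))
    R-disj = ∧-elimʳ {unionCondᵇ B N} (∧-elimʳ {pairwiseNDᵇ N} (∧-elimʳ {all B N} ext))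
    N-in : all inR N ≡ true
    N-in = all-intro inR N (λ I I∈N → inR-intro (all-elim B N-B I∈N)
                                                (λ y∈I → subst (_ ∈_) ⋃N≡S (∈⋃⁺ N I∈N y∈I)))
    R⊆∁S : subᵇ R (∁ S) ≡ true
    R⊆∁S = ⊆-subᵇ R (∁ S) (λ {x} x∈R → x∉p⇒x∈∁p (λ x∈S →
      let (I , I∈N , x∈I) = ∈⋃⁻ N (subst (x ∈_) (sym ⋃N≡S) x∈S) in
      disjᵇ-elim R I (all-elim (disjᵇ R) R-disj I∈N) x∈R x∈I))
    maxima-⊆ : filterᵇ isMax N ≡ maxima
    maxima-⊆ = ⊑-covering⇒≡ (filterᵇ-mono isMax N⊑) (allSubsets-⊑-Uniq (filterᵇ-⊑ isMax _))
      (λ K K∈ → let K-max = proj₂ (∈-filterᵇ⁻ isMax {allSubsets n} K∈) in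
                ∈-filterᵇ⁺ isMax (isMax-∈-covering N (allSubsets-⊑-Uniq N⊑) K-max ⋃N≡S N-B nc) K-max)
    all-maxima : (length (filterᵇ isMax N) ≡ᵇ length maxima) ≡ true
    all-maxima = T⇒≡true (≡⇒≡ᵇ _ _ (cong length maxima-⊆))

  coveringExtNested⇐ : (N : List (Subset n)) → N ⊑ allSubsets n → (R : Subset n) →
    coveringShapeᵇ N R ≡ true →
    (eqSubsetᵇ (⋃ N) S ∧ isExtNestedᵇ B N R) ≡ true
  coveringExtNested⇐ N N⊑ R e =
    ∧-intro (subst (λ U → eqSubsetᵇ U S ≡ true) (sym ⋃N≡S) (eqSubsetᵇ-refl S))
            (∧-intro N-B (∧-intro (∧-elimˡ {pairwiseNDᵇ N} nc) (∧-intro (∧-elimʳ {pairwiseNDᵇ N} nc) R-disj)))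
    where
    all-maxima = ∧-elimˡ e
    R⊆∁S = ∧-elimˡ (∧-elimʳ {length (filterᵇ isMax N) ≡ᵇ length maxima} e)
    rest = ∧-elimʳ {subᵇ R (∁ S)} (∧-elimʳ {length (filterᵇ isMax N) ≡ᵇ length maxima} e)
    N-in : all inR N ≡ true
    N-in = all-intro inR N (λ I → inR-nonMaxima N (∧-elimˡ rest))
    nc : nestedCondᵇ B N ≡ true
    nc = nestedCondᵇ-addMaxima N N-in (∧-elimʳ {all inR (filterᵇ notMax N)} rest)
    N-B : all B N ≡ true
    N-B = all-intro B N (λ I I∈N → inR⇒B (all-elim inR N-in I∈N))
    R-disj : all (disjᵇ R) N ≡ true
    R-disj = all-intro (disjᵇ R) N (λ I I∈N → disjᵇ-intro R I (λ x∈R x∈I →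
      x∈∁p⇒x∉p (subᵇ-⊆ R (∁ S) R⊆∁S x∈R) (inR⇒⊆S (all-elim inR N-in I∈N) x∈I)))
    maxima-⊆ : filterᵇ isMax N ≡ maxima
    maxima-⊆ = ≋⇒≡ (to-≋ (≡ᵇ⇒≡ _ _ (≡true⇒T all-maxima)) (filterᵇ-mono isMax N⊑))
    ⋃N≡S : ⋃ N ≡ S
    ⋃N≡S = ⊆-antisym (⋃⊆S N N-in) S⊆⋃N
      where
      -- Every point x of S lies in the maximal element above the singleton {x} ∈ B|_S.
      S⊆⋃N : S ⊆ ⋃ N
      S⊆⋃N {x} x∈S = ∈⋃⁺ N (proj₁ (∈-filterᵇ⁻ isMax {N} K∈N)) (x∈⁅x⁆⊆K (x∈⁅x⁆ x))
        where
        x-in : inR ⁅ x ⁆ ≡ true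
        x-in = inR-intro (proj₁ (proj₂ hB) x) (λ y∈⁅x⁆ → subst (_∈ S) (sym (x∈⁅y⁆⇒x≡y x y∈⁅x⁆)) x∈S)
        K = proj₁ (isMax-above x-in)
        x∈⁅x⁆⊆K = proj₂ (proj₂ (isMax-above x-in))
        K∈N : K ∈L filterᵇ isMax N
        K∈N = subst (K ∈L_) (sym maxima-⊆) (∈-filterᵇ⁺ isMax (allSubsets-complete n K) (proj₁ (proj₂ (isMax-above x-in))))

  coveringExtNested≡ : (N : List (Subset n)) → N ⊑ allSubsets n → (R : Subset n) →
    (eqSubsetᵇ (⋃ N) S ∧ isExtNestedᵇ B N R)
    ≡ coveringShapeᵇ N R
  coveringExtNested≡ N N⊑ R = bool-ext (coveringExtNested⇒ N N⊑ R) (coveringExtNested⇐ N N⊑ R)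

  isExtNestedᵇ-∁≡ : (N : List (Subset n)) → isExtNestedᵇ B N (∁ S) ≡ (all inR N ∧ nestedCondᵇ B N)
  isExtNestedᵇ-∁≡ N = begin
    all B N ∧ pairwiseNDᵇ N ∧ unionCondᵇ B N ∧ all (disjᵇ (∁ S)) N
      ≡⟨ cong (λ b → all B N ∧ pairwiseNDᵇ N ∧ unionCondᵇ B N ∧ b) (all-cong N (disjᵇ-∁ S)) ⟩
    all B N ∧ pairwiseNDᵇ N ∧ unionCondᵇ B N ∧ all (λ I → subᵇ I S) N
      ≡⟨ ∧-rearrange (all B N) (pairwiseNDᵇ N) (unionCondᵇ B N) (all (λ I → subᵇ I S) N) ⟩
    (all B N ∧ all (λ I → subᵇ I S) N) ∧ nestedCondᵇ B N
      ≡⟨ cong (_∧ nestedCondᵇ B N) (all-∧ B (λ I → subᵇ I S) N) ⟩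
    all inR N ∧ nestedCondᵇ B N ∎
    where open ≡-Reasoning

  nestedCondᵇ-dropMaxima : (N : List (Subset n)) →
    (all inR N ∧ nestedCondᵇ B N) ≡ (all inR (filterᵇ notMax N) ∧ nestedCondᵇ B (filterᵇ notMax N))
  nestedCondᵇ-dropMaxima N = bool-ext
    (λ e → ∧-intro (all-intro inR _ (λ I m → all-elim inR (∧-elimˡ e) (lookup (filterᵇ-⊑ notMax N) m)))
                   (nestedCondᵇ-⊑ B (filterᵇ-⊑ notMax N) (∧-elimʳ {all inR N} e)))
    (λ e → let N-in = all-intro inR N (λ I → inR-nonMaxima N (∧-elimˡ e)) in
           ∧-intro N-in (nestedCondᵇ-addMaxima N N-in (∧-elimʳ {all inR (filterᵇ notMax N)} e)))

  -- A nested collection of B|_S together with all maximal elements is still nested, so NestedBound applies.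
  length+numMax≤∣S∣ : (N : List (Subset n)) → N ⊑ candidates → nestedCondᵇ B N ≡ true →
    length N + length maxima ≤ ∣ S ∣
  length+numMax≤∣S∣ N N⊑ nc = subst (_≤ ∣ S ∣) (length-++ N)
    (NestedBound.length≤∣S∣ B hB X X-Uniq (∧-elimˡ X-nc) (∧-elimʳ {pairwiseNDᵇ X} X-nc) S X-in)
    where
    X = N ++ maxima
    N-cand : all (λ I → inR I ∧ not (isMax I)) N ≡ true
    N-cand = ⊑-filterᵇ⇒all (λ I → inR I ∧ not (isMax I)) {L = allSubsets n} N⊑
    X-Uniq : Uniq X
    X-Uniq = Uniq-++ N maxima (allSubsets-⊑-Uniq (⊆-trans N⊑ (filterᵇ-⊑ _ _))) (allSubsets-⊑-Uniq (filterᵇ-⊑ isMax _))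
      (λ I I∈N I∈max → true≢false (proj₂ (∈-filterᵇ⁻ isMax {allSubsets n} I∈max))
                                  (not-elim (∧-elimʳ {inR I} (all-elim _ N-cand I∈N))))
    X-in : all inR X ≡ true
    X-in = all-intro inR X (λ I I∈X →
      [ (λ I∈N → ∧-elimˡ (all-elim _ N-cand I∈N)) , (λ I∈max → isMax⇒inR (proj₂ (∈-filterᵇ⁻ isMax {allSubsets n} I∈max))) ]′
      (∈-++⁻ N I∈X))
    X-nonMaxima : filterᵇ notMax X ≡ N
    X-nonMaxima = begin
      filterᵇ notMax (N ++ maxima)
        ≡⟨ filterᵇ-++ notMax N maxima ⟩
      filterᵇ notMax N ++ filterᵇ notMax maxima
        ≡⟨ cong₂ _++_ (filterᵇ-all notMax N (all-intro notMax N (λ I m → ∧-elimʳ {inR I} (all-elim _ N-cand m))))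
                      (filterᵇ-none notMax maxima (λ I m → cong not (proj₂ (∈-filterᵇ⁻ isMax {allSubsets n} m)))) ⟩
      N ++ []
        ≡⟨ ++-identityʳ N ⟩
      N ∎
      where open ≡-Reasoning
    X-nc : nestedCondᵇ B X ≡ true
    X-nc = nestedCondᵇ-addMaxima X X-in (subst (λ M → nestedCondᵇ B M ≡ true) (sym X-nonMaxima) nc)

-- Counting faces

monomial : ℕ → Poly
monomial k i = 𝟙 (i ≡ᵇ k)

-- The coefficient of t^i contributed by a face of codimension k of a d-dimensional polytope.
faceTerm : ℕ → ℕ → Poly
faceTerm d k i = if i ≤ᵇ d then 𝟙 (k ≡ᵇ d ∸ i) else 0

faceTerm≡monomial : ∀ {d k c} → k + c ≡ d → ∀ i → faceTerm d k i ≡ monomial c i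
faceTerm≡monomial {d} {k} {c} k+c≡d i with i ≤ᵇ d in i≤ᵇd
... | true  = cong 𝟙 (bool-ext (λ e → T⇒≡true (≡⇒≡ᵇ i c (i≡c (≡ᵇ⇒≡ k (d ∸ i) (≡true⇒T e)))))
                               (λ e → T⇒≡true (≡⇒≡ᵇ k (d ∸ i) (k≡d∸i (≡ᵇ⇒≡ i c (≡true⇒T e))))))
  where
  i≤d : i ≤ d
  i≤d = ≤ᵇ⇒≤ i d (≡true⇒T i≤ᵇd)
  i≡c : k ≡ d ∸ i → i ≡ c
  i≡c k≡d∸i = +-cancelˡ-≡ k i c (trans (cong (_+ i) k≡d∸i) (trans (m∸n+n≡m i≤d) (sym k+c≡d)))
  k≡d∸i : i ≡ c → k ≡ d ∸ i
  k≡d∸i refl = sym (trans (cong (_∸ i) (sym k+c≡d)) (m+n∸n≡m k i))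
... | false with i ≡ᵇ c in i≡ᵇc
...   | false = refl
...   | true  = contradiction i≤d (λ i≤d → true≢false (T⇒≡true (≤⇒≤ᵇ i≤d)) i≤ᵇd)
  where
  i≤d : i ≤ d
  i≤d = subst (_≤ d) (sym (≡ᵇ⇒≡ i c (≡true⇒T i≡ᵇc))) (subst (c ≤_) k+c≡d (m≤n+m c k))

mulT^-monomial : ∀ a c i → mulT^ a (monomial c) i ≡ monomial (a + c) i
mulT^-monomial zero    c i       = refl
mulT^-monomial (suc a) c zero    = refl
mulT^-monomial (suc a) c (suc i) = mulT^-monomial a c i

faceTerm-mulT^ : ∀ {d k c a D} → a ≤ D → k + (c + (D ∸ a)) ≡ d → ∀ i → faceTerm d k i ≡ mulT^ c (faceTerm D a) i
faceTerm-mulT^ {d} {k} {c} {a} {D} a≤D eq i = begin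
  faceTerm d k i                   ≡⟨ faceTerm≡monomial {d} {k} {c + (D ∸ a)} eq i ⟩
  monomial (c + (D ∸ a)) i         ≡⟨ mulT^-monomial c (D ∸ a) i ⟨
  mulT^ c (monomial (D ∸ a)) i     ≡⟨ mulT^-cong c i (faceTerm≡monomial (m+[n∸m]≡n a≤D)) ⟨
  mulT^ c (faceTerm D a) i         ∎
  where open ≡-Reasoning

codimension-arithmetic : ∀ b a r c {m s r′ n} → b + r + c ≡ m + r′ → a + m ≤ s → s + r′ ≡ n →
  b + a + r + (c + ((s ∸ m) ∸ a)) ≡ n
codimension-arithmetic b a r c {m} {s} {r′} eq a+m≤s refl with m≤n⇒∃[o]m+o≡n a+m≤s
... | e , refl = begin
  b + a + r + (c + ((a + m + e ∸ m) ∸ a))   ≡⟨ cong (λ k → b + a + r + (c + k)) leftover ⟩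
  b + a + r + (c + e)                        ≡⟨ solve-∀-shuffle b a r c e ⟩
  (b + r + c) + (a + e)                      ≡⟨ cong (_+ (a + e)) eq ⟩
  (m + r′) + (a + e)                         ≡⟨ solve-∀-back m r′ a e ⟩
  a + m + e + r′                             ∎
  where
  open ≡-Reasoning
  leftover : (a + m + e ∸ m) ∸ a ≡ e
  leftover = trans (∸-+-assoc (a + m + e) m a) (trans (cong (a + m + e ∸_) (+-comm m a)) (m+n∸m≡n (a + m) e))
  solve-∀-shuffle : ∀ b a r c e → b + a + r + (c + e) ≡ (b + r + c) + (a + e)
  solve-∀-shuffle = solve-∀
  solve-∀-back : ∀ m r′ a e → (m + r′) + (a + e) ≡ a + m + e + r′
  solve-∀-back = solve-∀

sumSubsets≡ΣL : ∀ n (F : Subset n → Poly) i → sumSubsets n F i ≡ ΣL (allSubsets n) (λ S → F S i)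
sumSubsets≡ΣL n F i = go (allSubsets n)
  where
  go : (Ss : List (Subset n)) → foldr (λ S acc → F S i + acc) 0 Ss ≡ ΣL Ss (λ S → F S i)
  go []       = refl
  go (S ∷ Ss) = cong (F S i +_) (go Ss)

module Counting {n : ℕ} (B : Subset n → Bool) (hB : IsBuildingSet B) where

  extTerm : ℕ → List (Subset n) → Subset n → ℕ
  extTerm i N R = if isExtNestedᵇ B N R then faceTerm n (length N + ∣ R ∣) i else 0

  fExt≡ΣL : ∀ i → fExt B i ≡ ΣL (allSubsets n) (λ R → ΣL (sublists (allSubsets n)) (λ N → extTerm i N R))
  fExt≡ΣL i = begin
    (if i ≤ᵇ n then length (filterᵇ counted (pairs Ns Rs)) else 0)
      ≡⟨ cong (λ k → if i ≤ᵇ n then k else 0) (length-filterᵇ-pairs counted Ns Rs) ⟩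
    (if i ≤ᵇ n then ΣL Ns (λ N → ΣL Rs (λ R → 𝟙 (counted (N , R)))) else 0)
      ≡⟨ trans (if-ΣL (i ≤ᵇ n) Ns _) (ΣL-cong Ns (λ N → if-ΣL (i ≤ᵇ n) Rs _)) ⟩
    ΣL Ns (λ N → ΣL Rs (λ R → if i ≤ᵇ n then 𝟙 (counted (N , R)) else 0))
      ≡⟨ ΣL-comm Ns Rs _ ⟩
    ΣL Rs (λ R → ΣL Ns (λ N → if i ≤ᵇ n then 𝟙 (counted (N , R)) else 0))
      ≡⟨ ΣL-cong Rs (λ R → ΣL-cong Ns (λ N → if-𝟙-∧ (i ≤ᵇ n) (isExtNestedᵇ B N R) _)) ⟩
    ΣL Rs (λ R → ΣL Ns (λ N → extTerm i N R)) ∎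
    where
    open ≡-Reasoning
    Rs = allSubsets n
    Ns = sublists Rs
    counted : List (Subset n) × Subset n → Bool
    counted (N , R) = isExtNestedᵇ B N R ∧ (length N + ∣ R ∣ ≡ᵇ n ∸ i)

  module _ (S : Subset n) where
    open Restriction B hB S

    d : ℕ
    d = ∣ S ∣ ∸ length maxima

    ΣNested : (ℕ → ℕ) → ℕ
    ΣNested w = ΣL (sublists candidates) (λ N → if nestedCondᵇ B N then w (length N) else 0)

    ΣL-nonMaxima : (f : List (Subset n) → ℕ) →
      ΣL (sublists nonMaxima) (λ N → if all inR N then f N else 0) ≡ ΣL (sublists candidates) f
    ΣL-nonMaxima f = trans (ΣL-sublists-filterᵇ inR nonMaxima f)
                           (cong (λ Is → ΣL (sublists Is) f) (filterᵇ-filterᵇ inR notMax (allSubsets n)))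

    fNest≡ΣNested : ∀ j → fNest B S j ≡ ΣNested (λ a → faceTerm d a j)
    fNest≡ΣNested j = begin
      (if j ≤ᵇ d then length (filterᵇ (λ N → isNestedᵇ B S N ∧ (length N ≡ᵇ d ∸ j)) Ns) else 0)
        ≡⟨ cong (λ k → if j ≤ᵇ d then k else 0) (trans (length-filterᵇ _ Ns) (ΣL-cong Ns split-candidates)) ⟩
      (if j ≤ᵇ d then ΣL Ns (λ N → if all candidate N then 𝟙 (nestedCondᵇ B N ∧ (length N ≡ᵇ d ∸ j)) else 0) else 0)
        ≡⟨ cong (λ k → if j ≤ᵇ d then k else 0) (ΣL-sublists-filterᵇ candidate (allSubsets n) _) ⟩
      (if j ≤ᵇ d then ΣL (sublists candidates) (λ N → 𝟙 (nestedCondᵇ B N ∧ (length N ≡ᵇ d ∸ j))) else 0)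
        ≡⟨ if-ΣL (j ≤ᵇ d) (sublists candidates) _ ⟩
      ΣL (sublists candidates) (λ N → if j ≤ᵇ d then 𝟙 (nestedCondᵇ B N ∧ (length N ≡ᵇ d ∸ j)) else 0)
        ≡⟨ ΣL-cong (sublists candidates) (λ N → if-𝟙-∧ (j ≤ᵇ d) (nestedCondᵇ B N) _) ⟩
      ΣNested (λ a → faceTerm d a j) ∎
      where
      open ≡-Reasoning
      Ns = sublists (allSubsets n)
      candidate = λ I → inR I ∧ not (isMax I)
      split-candidates : ∀ N → 𝟙 (isNestedᵇ B S N ∧ (length N ≡ᵇ d ∸ j))
                             ≡ (if all candidate N then 𝟙 (nestedCondᵇ B N ∧ (length N ≡ᵇ d ∸ j)) else 0)
      split-candidates N =
        trans (cong 𝟙 (BoolP.∧-assoc (all candidate N) (nestedCondᵇ B N) _)) (if-𝟙-∧ true (all candidate N) _)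

    mulT^-fNest : ∀ c i → mulT^ c (fNest B S) i ≡ ΣNested (λ a → mulT^ c (faceTerm d a) i)
    mulT^-fNest c i = begin
      mulT^ c (fNest B S) i
        ≡⟨ mulT^-cong c i fNest≡ΣNested ⟩
      mulT^ c (λ j → ΣNested (λ a → faceTerm d a j)) i
        ≡⟨ mulT^-ΣL c (sublists candidates) (λ j N → if nestedCondᵇ B N then faceTerm d (length N) j else 0) i ⟩
      ΣL (sublists candidates) (λ N → mulT^ c (λ j → if nestedCondᵇ B N then faceTerm d (length N) j else 0) i)
        ≡⟨ ΣL-cong (sublists candidates) (λ N → mulT^-if c (nestedCondᵇ B N) _ i) ⟩
      ΣNested (λ a → mulT^ c (faceTerm d a) i) ∎
      where open ≡-Reasoning

    ∣S∣+∣∁S∣≡n : ∣ S ∣ + ∣ ∁ S ∣ ≡ n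
    ∣S∣+∣∁S∣≡n = trans (cong (∣ S ∣ +_) (∣∁p∣≡n∸∣p∣ S)) (m+[n∸m]≡n (∣p∣≤n S))

    -- Adding b faces from maximal elements and r from points outside S to each nested collection shifts fNest by t^c.
    ΣNested-shift : ∀ b r c i → b + r + c ≡ length maxima + ∣ ∁ S ∣ →
      ΣNested (λ a → faceTerm n (b + a + r) i) ≡ mulT^ c (fNest B S) i
    ΣNested-shift b r c i eq = trans (ΣL-sublists-cong candidates shift) (sym (mulT^-fNest c i))
      where
      shift : ∀ N → N ⊑ candidates → (if nestedCondᵇ B N then faceTerm n (b + length N + r) i else 0)
                                     ≡ (if nestedCondᵇ B N then mulT^ c (faceTerm d (length N)) i else 0)
      shift N N⊑ with nestedCondᵇ B N in nc
      ... | false = refl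
      ... | true  = let bound = length+numMax≤∣S∣ N N⊑ nc in
        faceTerm-mulT^ {k = b + length N + r} {c = c} (m+n≤o⇒m≤o∸n (length N) bound)
                       (codimension-arithmetic b (length N) r c eq bound ∣S∣+∣∁S∣≡n) i

    ΣL-extTerm-∁ : ∀ i → ΣL (sublists (allSubsets n)) (λ N → extTerm i N (∁ S)) ≡ mulT1^ (length maxima) (fNest B S) i
    ΣL-extTerm-∁ i = begin
      ΣL (sublists (allSubsets n)) (λ N → extTerm i N (∁ S))
        ≡⟨ ΣL-sublists-partition isMax (allSubsets n) _ term (λ N _ → split N) ⟩
      ΣL (sublists maxima) (λ M → ΣL (sublists nonMaxima) (term M))
        ≡⟨ ΣL-cong (sublists maxima) (λ M → trans (ΣL-cong (sublists nonMaxima) (λ N → if-∧ (all inR N) _ _))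
                                                  (ΣL-nonMaxima _)) ⟩
      ΣL (sublists maxima) (λ M → ΣNested (λ a → faceTerm n (length M + a + ∣ ∁ S ∣) i))
        ≡⟨ ΣL-sublists-cong maxima (λ M M⊑ → ΣNested-shift (length M) (∣ ∁ S ∣) (length maxima ∸ length M) i (exponent M M⊑)) ⟩
      ΣL (sublists maxima) (λ M → mulT^ (length maxima ∸ length M) (fNest B S) i)
        ≡⟨ mulT1^-binomial maxima (fNest B S) i ⟨
      mulT1^ (length maxima) (fNest B S) i ∎
      where
      open ≡-Reasoning
      term : List (Subset n) → List (Subset n) → ℕ
      term M N = if all inR N ∧ nestedCondᵇ B N then faceTerm n (length M + length N + ∣ ∁ S ∣) i else 0
      split : ∀ N → extTerm i N (∁ S) ≡ term (filterᵇ isMax N) (filterᵇ notMax N)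
      split N = cong₂ (λ b k → if b then faceTerm n (k + ∣ ∁ S ∣) i else 0)
                      (trans (isExtNestedᵇ-∁≡ N) (nestedCondᵇ-dropMaxima N)) (length-filterᵇ-partition isMax N)
      exponent : ∀ M → M ⊑ maxima → length M + ∣ ∁ S ∣ + (length maxima ∸ length M) ≡ length maxima + ∣ ∁ S ∣
      exponent M M⊑ = begin
        length M + ∣ ∁ S ∣ + (length maxima ∸ length M)   ≡⟨ +-assoc (length M) _ _ ⟩
        length M + (∣ ∁ S ∣ + (length maxima ∸ length M)) ≡⟨ cong (length M +_) (+-comm (∣ ∁ S ∣) _) ⟩
        length M + ((length maxima ∸ length M) + ∣ ∁ S ∣) ≡⟨ +-assoc (length M) _ _ ⟨
        length M + (length maxima ∸ length M) + ∣ ∁ S ∣   ≡⟨ cong (_+ ∣ ∁ S ∣) (m+[n∸m]≡n (length-mono-≤ M⊑)) ⟩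
        length maxima + ∣ ∁ S ∣ ∎

    ΣL-extTerm-covering : ∀ i R → ΣL (sublists (allSubsets n)) (λ N → if eqSubsetᵇ (⋃ N) S then extTerm i N R else 0)
                                ≡ (if subᵇ R (∁ S) then mulT^ (∣ ∁ S ∣ ∸ ∣ R ∣) (fNest B S) i else 0)
    ΣL-extTerm-covering i R = begin
      ΣL (sublists (allSubsets n)) (λ N → if eqSubsetᵇ (⋃ N) S then extTerm i N R else 0)
        ≡⟨ ΣL-sublists-partition isMax (allSubsets n) _ term split ⟩
      ΣL (sublists maxima) (λ M → ΣL Cs (term M))
        ≡⟨ ΣL-cong (sublists maxima) (λ M → trans (ΣL-cong Cs (λ N → if-∧ (length M ≡ᵇ length maxima) _ _))
                                                  (sym (if-ΣL _ Cs _))) ⟩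
      ΣL (sublists maxima) (λ M → if length M ≡ᵇ length maxima then ΣL Cs (inner (length M)) else 0)
        ≡⟨ ΣL-sublists-full maxima (λ b → ΣL Cs (inner b)) ⟩
      ΣL Cs (inner (length maxima))
        ≡⟨ trans (ΣL-cong Cs (λ N → if-∧ (subᵇ R (∁ S)) _ _)) (sym (if-ΣL (subᵇ R (∁ S)) Cs _)) ⟩
      (if subᵇ R (∁ S) then ΣL Cs (λ N → if all inR N ∧ nestedCondᵇ B N then faceTerm n (codim (length N)) i else 0) else 0)
        ≡⟨ cong (λ k → if subᵇ R (∁ S) then k else 0) (trans (ΣL-cong Cs (λ N → if-∧ (all inR N) _ _)) (ΣL-nonMaxima _)) ⟩
      (if subᵇ R (∁ S) then ΣNested (λ a → faceTerm n (codim a) i) else 0)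
        ≡⟨ shift (subᵇ R (∁ S)) refl ⟩
      (if subᵇ R (∁ S) then mulT^ (∣ ∁ S ∣ ∸ ∣ R ∣) (fNest B S) i else 0) ∎
      where
      open ≡-Reasoning
      Cs = sublists nonMaxima
      codim : ℕ → ℕ
      codim a = length maxima + a + ∣ R ∣
      inner : ℕ → List (Subset n) → ℕ
      inner b N = if subᵇ R (∁ S) ∧ all inR N ∧ nestedCondᵇ B N then faceTerm n (b + length N + ∣ R ∣) i else 0
      term : List (Subset n) → List (Subset n) → ℕ
      term M N = if (length M ≡ᵇ length maxima) ∧ subᵇ R (∁ S) ∧ all inR N ∧ nestedCondᵇ B N
                 then faceTerm n (length M + length N + ∣ R ∣) i else 0
      split : ∀ N → N ⊑ allSubsets n →
        (if eqSubsetᵇ (⋃ N) S then extTerm i N R else 0) ≡ term (filterᵇ isMax N) (filterᵇ notMax N)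
      split N N⊑ = trans (sym (if-∧ (eqSubsetᵇ (⋃ N) S) (isExtNestedᵇ B N R) _))
                         (cong₂ (λ b k → if b then faceTerm n (k + ∣ R ∣) i else 0)
                                (coveringExtNested≡ N N⊑ R) (length-filterᵇ-partition isMax N))
      shift : ∀ b → subᵇ R (∁ S) ≡ b →
        (if b then ΣNested (λ a → faceTerm n (codim a) i) else 0) ≡ (if b then mulT^ (∣ ∁ S ∣ ∸ ∣ R ∣) (fNest B S) i else 0)
      shift false _    = refl
      shift true  R⊆∁S = ΣNested-shift (length maxima) (∣ R ∣) (∣ ∁ S ∣ ∸ ∣ R ∣) i
        (trans (+-assoc (length maxima) _ _) (cong (length maxima +_) (m+[n∸m]≡n (p⊆q⇒∣p∣≤∣q∣ (subᵇ-⊆ R (∁ S) R⊆∁S)))))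

  fExt-by-union : ∀ i → fExt B i ≡ sumSubsets n (λ S → mulT1^ (n ∸ ∣ S ∣) (fNest B S)) i
  fExt-by-union i = begin
    fExt B i
      ≡⟨ fExt≡ΣL i ⟩
    ΣL Rs (λ R → ΣL Ns (λ N → extTerm i N R))
      ≡⟨ ΣL-cong Rs (λ R → ΣL-cong Ns (λ N → ΣL-allSubsets-eqSubsetᵇ n (⋃ N) (λ _ → extTerm i N R))) ⟨
    ΣL Rs (λ R → ΣL Ns (λ N → ΣL Rs (λ S → if eqSubsetᵇ (⋃ N) S then extTerm i N R else 0)))
      ≡⟨ trans (ΣL-cong Rs (λ R → ΣL-comm Ns Rs _)) (ΣL-comm Rs Rs _) ⟩
    ΣL Rs (λ S → ΣL Rs (λ R → ΣL Ns (λ N → if eqSubsetᵇ (⋃ N) S then extTerm i N R else 0)))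
      ≡⟨ ΣL-cong Rs (λ S → ΣL-cong Rs (ΣL-extTerm-covering S i)) ⟩
    ΣL Rs (λ S → ΣL Rs (λ R → if subᵇ R (∁ S) then mulT^ (∣ ∁ S ∣ ∸ ∣ R ∣) (fNest B S) i else 0))
      ≡⟨ ΣL-cong Rs (λ S → trans (sym (mulT1^-binomial-subsets n (∁ S) (fNest B S) i))
                                 (cong (λ k → mulT1^ k (fNest B S) i) (∣∁p∣≡n∸∣p∣ S))) ⟩
    ΣL Rs (λ S → mulT1^ (n ∸ ∣ S ∣) (fNest B S) i)
      ≡⟨ sumSubsets≡ΣL n (λ S → mulT1^ (n ∸ ∣ S ∣) (fNest B S)) i ⟨
    sumSubsets n (λ S → mulT1^ (n ∸ ∣ S ∣) (fNest B S)) i ∎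
    where
    open ≡-Reasoning
    Rs = allSubsets n
    Ns = sublists Rs

  fExt-by-complement : ∀ i → fExt B i ≡ sumSubsets n (λ S → mulT1^ (numMax B S) (fNest B S)) i
  fExt-by-complement i = begin
    fExt B i
      ≡⟨ fExt≡ΣL i ⟩
    ΣL Rs (λ R → ΣL Ns (λ N → extTerm i N R))
      ≡⟨ ΣL-allSubsets-∁ n _ ⟩
    ΣL Rs (λ S → ΣL Ns (λ N → extTerm i N (∁ S)))
      ≡⟨ ΣL-cong Rs (λ S → ΣL-extTerm-∁ S i) ⟩
    ΣL Rs (λ S → mulT1^ (numMax B S) (fNest B S) i)
      ≡⟨ sumSubsets≡ΣL n (λ S → mulT1^ (numMax B S) (fNest B S)) i ⟨
    sumSubsets n (λ S → mulT1^ (numMax B S) (fNest B S)) i ∎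
    where
    open ≡-Reasoning
    Rs = allSubsets n
    Ns = sublists Rs

theorem5p4 : (n : ℕ) (B : Subset n → Bool) → IsBuildingSet B →
  (∀ (i : ℕ) → fExt B i ≡ sumSubsets n (λ S → mulT1^ (n ∸ ∣ S ∣) (fNest B S)) i)
  × (∀ (i : ℕ) → fExt B i ≡ sumSubsets n (λ S → mulT1^ (numMax B S) (fNest B S)) i)
theorem5p4 n B hB = Counting.fExt-by-union B hB , Counting.fExt-by-complement B hB
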